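{- Let $T$ be a rooted tree, let $H$ be a spanning subgraph of $\mathrm{clos}(T)$, and let $\mathbf{k}=(k_s:s\in V(T))\in\mathbb{N}^{|V(T)|}$. For each $s\in V(T)$ let $(F_{s;\mathbf{j}_s})$, $\mathbf{j}_s\in\mathbb{N}^{h_s}$, be a strongly polynomial sequence of graphs. Then the sequence of branched compositions $\big(T^{\mathbf{k}}(H)[\{F_{s;\mathbf{j}_s}:s\in V(T)\}]\big)$ is strongly polynomial in $(\mathbf{j},\mathbf{k})$, where $\mathbf{j}=(\mathbf{j}_s:s\in V(T))$.
   Context: All graphs are finite and may have loops, multiple edges or edge weights; a weighted graph $H$ is given by a symmetric matrix $(a_{i,j})$ of weights on pairs of vertices (including $i=j$, loops). For a multigraph $G$, $\mathrm{hom}(G,H)=\sum_{f:V(G)\to V(H)}\prod_{uv\in E(G)}a_{f(u),f(v)}$ (edges of $G$ counted with multiplicity); for simple $H$ this is the number of homomorphisms. $\mathbb{N}$ denotes the positive integers. A sequence $(H_{\mathbf{k}})$ indexed by all $\mathbf{k}\in\mathbb{N}^h$ is strongly polynomial if for every graph $G$ there is a polynomial $p(G;x_1,\dots,x_h)$ with $\mathrm{hom}(G,H_{\mathbf{k}})=p(G;\mathbf{k})$ for all $\mathbf{k}\in\mathbb{N}^h$. Rooted trees: for a rooted tree $T$ with root $r$ and $s\in V(T)$, $P(s)$ is the vertex set of the unique path from $r$ to $s$ (including $r$ and $s$); $t\neq s$ is an ancestor of $s$ if $t\in P(s)$. The closure $\mathrm{clos}(T)$ is the simple graph on $V(T)$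 in which $s\neq t$ are adjacent iff one is an ancestor of the other. Branching: for $\mathbf{k}=(k_s)_{s\in V(T)}$, the $\mathbf{k}$-branching $T^{\mathbf{k}}$ is the rooted forest whose vertices are the pairs $(s,\varphi)$ with $s\in V(T)$ and $\varphi$ a function assigning to each $t\in P(s)$ an element of $\{1,\dots,k_t\}$ (so $s$ has $\prod_{t\in P(s)}k_t$ copies, and the root $r$ has $k_r$ copies), where $(t,\psi)$ is an ancestor of $(s,\varphi)$ iff $t$ is an ancestor of $s$ in $T$ and $\psi=\varphi|_{P(t)}$. If $H$ is a spanning subgraph of $\mathrm{clos}(T)$, $T^{\mathbf{k}}(H)$ is the simple graph on $V(T^{\mathbf{k}})$ in which $(s,\varphi)$ and $(t,\psi)$ with $t$ an ancestor of $s$ are adjacent iff $\psi=\varphi|_{P(t)}$ and $st\in E(H)$ (each copy of $s$ is joined to exactly those of its ancestors in $T^{\mathbf{k}}$ that are copies of neighbours of $s$ in $H$ lying on $P(s)$). Composition: given a simple graph $K$ and graphs $F_v$ for $v\in V(K)$ (an ornamentation), $K[\{F_v\}]$ is formed by taking the disjoint union of the $F_v$ and adding all edges between $F_u$ and $F_v$ whenever $uv\in E(K)$. In $T^{\mathbf{k}}(H)[\{F_{s;\mathbf{j}_s}\}]$ every copy $(s,\varphi)$ of $s$ is ornamented by $F_{s;\mathbf{j}_s}$. -}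

module Defs where

open import Data.Nat as ℕ using (ℕ; zero; suc; _≤_)
open import Data.Nat.Properties using () renaming (_≟_ to _≟ℕ_)
open import Data.Fin as Fin using (Fin; _≟_)
open import Data.Integer using (+_)
open import Data.Rational as ℚ using (ℚ; _/_)
open import Data.List as List using (List; []; _∷_; [_]; map; concatMap; upTo; allFin; length; drop; lookup)
open import Data.List.Properties using (≡-dec)
open import Data.Nat.ListAction using (sum; product)
open import Data.Vec as Vec using (Vec)
open import Data.Bool using (Bool; true; false; if_then_else_; _∧_; _∨_)
open import Data.Product using (Σ; ∃; _×_; _,_)
open import Data.Sum using (_⊎_; inj₁; inj₂)
open import Function using (_∘_)
open import Relation.Nullary using (¬_; yes; no)
open import Relation.Nullary.Decidable using (⌊_⌋)
open import Relation.Binary.PropositionalEquality using (_≡_; refl)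

-- A (target) graph: vertex set Fin size, and an ℕ-valued weight matrix
-- (edge multiplicities; diagonal entries = loops).
record Graph : Set where
  field
    size : ℕ
    adj  : Fin size → Fin size → ℕ
open Graph public

Symmetric : Graph → Set
Symmetric F = ∀ u v → adj F u v ≡ adj F v u

-- A finite multigraph (source graph) with vertex set Fin n, given by its
-- list of edges (repetitions = multiple edges, (u , u) = loop).
record MGraph : Set where
  field
    n     : ℕ
    edges : List (Fin n × Fin n)
open MGraph public

allMaps : (n m : ℕ) → List (Vec (Fin m) n)
allMaps zero    m = [ Vec.[] ]
allMaps (suc n) m = concatMap (λ f → map (λ i → i Vec.∷ f) (allFin m)) (allMaps n m)

hom : MGraph → Graph → ℕ
hom G H = sum (map (λ f → product
            (map (λ e → adj H (Vec.lookup f (Data.Product.proj₁ e))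
                              (Vec.lookup f (Data.Product.proj₂ e)))
                 (edges G)))
          (allMaps (n G) (size H)))

data Poly (I : Set) : Set where
  con  : ℚ → Poly I
  var  : I → Poly I
  _⊕_  : Poly I → Poly I → Poly I
  _⊗_  : Poly I → Poly I → Poly I

evalP : {I : Set} → (I → ℕ) → Poly I → ℚ
evalP x (con q) = q
evalP x (var i) = + x i / 1
evalP x (p ⊕ q) = evalP x p ℚ.+ evalP x q
evalP x (p ⊗ q) = evalP x p ℚ.* evalP x q

toℚ : ℕ → ℚ
toℚ m = + m / 1

-- Positive-integer index vectors: x ∈ ℕ^I with ℕ = positive integers.
Positive : {I : Set} → (I → ℕ) → Set
Positive {I} x = ∀ (i : I) → 1 ≤ x i

StronglyPolynomial : {I : Set} → ((I → ℕ) → Graph) → Set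
StronglyPolynomial {I} Hs =
  ∀ (G : MGraph) → ∃ λ (p : Poly I) →
    ∀ (x : I → ℕ) → Positive x → toℚ (hom G (Hs x)) ≡ evalP x p

iter : {A : Set} → (A → A) → ℕ → A → A
iter f zero    a = a
iter f (suc d) a = f (iter f d a)

record RootedTree (N : ℕ) : Set where
  field
    root        : Fin N
    parent      : Fin N → Fin N
    parent-root : parent root ≡ root
    reaches     : ∀ s → ∃ λ d → iter parent d s ≡ root
open RootedTree public

Ancestor : ∀ {N} → RootedTree N → Fin N → Fin N → Set
Ancestor T t s = ¬ (t ≡ s) × ∃ λ d → iter (parent T) d s ≡ t

SpanningSubgraphOfClos : ∀ {N} → RootedTree N → (Fin N → Fin N → Bool) → Set
SpanningSubgraphOfClos {N} T H =
  (∀ s t → H s t ≡ H t s) ×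
  (∀ s t → H s t ≡ true → Ancestor T t s ⊎ Ancestor T s t)

-- P(s) as a list s, parent s, ..., root (fuel N suffices for a tree)
pathFrom : ∀ {N} → RootedTree N → ℕ → Fin N → List (Fin N)
pathFrom T zero    s = [ s ]
pathFrom T (suc f) s with s ≟ root T
... | yes _ = [ s ]
... | no  _ = s ∷ pathFrom T f (parent T s)

P : ∀ {N} → RootedTree N → Fin N → List (Fin N)
P {N} T s = pathFrom T N s

-- all functions φ on a path, assigning to t a copy index in {0,...,k_t - 1}
-- (listed in path order)
assignments : ∀ {N} → (Fin N → ℕ) → List (Fin N) → List (List ℕ)
assignments k []       = [ [] ]
assignments k (t ∷ ts) = concatMap (λ c → map (c ∷_) (assignments k ts)) (upTo (k t))

-- restriction of φ (on P(s)) to P(t) for an ancestor t: P(t) is the final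
-- segment of P(s), so this is dropping the first |P(s)|-|P(t)| entries.
restrictsTo : List ℕ → List ℕ → Bool
restrictsTo φ ψ = ⌊ ≡-dec _≟ℕ_ (drop (length φ ℕ.∸ length ψ) φ) ψ ⌋

-- Branched composition  T^k(H)[{F_{s;j_s}}]
-- Index variables: inj₁ (s , i) = i-th coordinate of j_s, inj₂ s = k_s.

Idx : ∀ {N} → (Fin N → ℕ) → Set
Idx {N} h = (Σ (Fin N) λ s → Fin (h s)) ⊎ Fin N

module Branched {N : ℕ} (T : RootedTree N) (H : Fin N → Fin N → Bool)
                (h : Fin N → ℕ) (F : (s : Fin N) → (Fin (h s) → ℕ) → Graph)
                (x : Idx h → ℕ) where

  j : (s : Fin N) → Fin (h s) → ℕ
  j s i = x (inj₁ (s , i))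

  k : Fin N → ℕ
  k s = x (inj₂ s)

  -- a vertex: copy (s , φ) of s in T^k, and a vertex v of F_{s;j_s}
  Vtx : Set
  Vtx = Σ (Fin N) λ s → List ℕ × Fin (size (F s (j s)))

  verts : List Vtx
  verts = concatMap (λ s → concatMap (λ φ → map (λ v → (s , φ , v))
                                                 (allFin (size (F s (j s)))))
                                      (assignments k (P T s)))
                    (allFin N)

  adjV : Vtx → Vtx → ℕ
  adjV (s , φ , v) (t , ψ , w) with s ≟ t
  ... | yes refl = if ⌊ ≡-dec _≟ℕ_ φ ψ ⌋ then adj (F s (j s)) v w else 0
  ... | no  _    = if H s t ∧ (restrictsTo φ ψ ∨ restrictsTo ψ φ) then 1 else 0

  graph : Graph
  graph = record { size = length verts
                 ; adj  = λ a b → adjV (lookup verts a) (lookup verts b) }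

branchedComposition : ∀ {N} → RootedTree N → (Fin N → Fin N → Bool) →
  (h : Fin N → ℕ) → ((s : Fin N) → (Fin (h s) → ℕ) → Graph) →
  (Idx h → ℕ) → Graph
branchedComposition T H h F x = Branched.graph T H h F x

-- A homomorphism from G into the branched composition assigns to every vertex u of G a type
-- σ u ∈ V(T), a copy of σ u (a choice of copy indices along the path from the root to σ u) and a
-- vertex of the ornament of σ u.  For fixed σ the count factors: the ornament vertices contribute
-- ∏_s hom(G[σ⁻¹ s], F_s), polynomial in j by hypothesis, and the copies contribute the number of
-- copy choices compatible with the edges of G.  Because H ⊆ clos(T), an edge of G only asks two
-- copies to agree along the shorter of the two paths, which is an initial segment of the longer:
-- a system of equations between indices of the same type t ∈ V(T).  Eliminating its variables one
-- at a time shows that its number of solutions is a product of k_t's, hence polynomial in k.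

module Submission where

open import Defs
open import Data.Bool using (Bool; true; false; if_then_else_; _∧_; _∨_)
open import Data.Bool.Properties using (∨-comm; ∨-zeroʳ; ∨-identityʳ)
open import Data.Empty using (⊥-elim)
open import Data.Fin as Fin using (Fin; toℕ; fromℕ<; _≟_)
import Data.Fin.Properties as Fin
import Data.Integer as ℤ
import Data.Integer.Properties as ℤ
open import Data.List as List using (List; []; _∷_; [_]; _++_; map; concatMap; upTo; allFin; length)
import Data.List.Properties as List
open import Data.List.Properties using (≡-dec)
open import Data.List.Membership.Propositional using (_∈_; find)
open import Data.List.Membership.Propositional.Properties using (∈-map⁻; ∈-concatMap⁻; ∈-upTo⁻)
open import Data.List.Relation.Binary.Pointwise using (Pointwise; []; _∷_; Pointwise-length)
open import Data.List.Relation.Unary.All as All using (All; []; _∷_)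
open import Data.List.Relation.Unary.All.Properties using (++⁺; map⁺; concat⁺; applyUpTo⁺₁)
open import Data.List.Relation.Unary.Any using (here)
open import Data.Maybe using (Maybe; just; nothing; fromMaybe)
open import Data.Nat as ℕ using (ℕ; zero; suc; _+_; _*_; _<_; _≤_; _∸_; s≤s; z<s; s<s; _<?_; _≤?_)
open import Data.Nat.ListAction using (sum; product)
open import Data.Nat.ListAction.Properties using (sum-++; product-++)
open import Data.Nat.Properties renaming (_≟_ to _≟ℕ_)
open import Algebra.Properties.CommutativeSemigroup +-commutativeSemigroup
  using () renaming (interchange to +-interchange)
open import Algebra.Properties.CommutativeSemigroup *-commutativeSemigroup
  using () renaming (interchange to *-interchange; x∙yz≈y∙xz to *-exchangeˡ)
open import Data.Product using (∃; _×_; _,_; proj₁; proj₂)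
import Data.Rational as ℚ
open import Data.Rational.Properties using (toℚᵘ-injective; toℚᵘ-fromℚᵘ; toℚᵘ-homo-+; toℚᵘ-homo-*)
open import Data.Rational.Unnormalised as ℚᵘ using (mkℚᵘ; *≡*)
import Data.Rational.Unnormalised.Properties as ℚᵘ
open import Data.Sum using (inj₁; inj₂)
open import Data.Vec as Vec using (Vec; []; _∷_)
import Data.Vec.Properties as Vec
open import Function using (_∘_)
open import Relation.Binary.PropositionalEquality hiding ([_])
open import Relation.Nullary using (¬_; yes; no; does)
open import Relation.Nullary.Decidable using (⌊_⌋; isYes≗does; dec-true)

private variable
  A B C D : Set
  m : ℕ

∑ ∏ : List A → (A → ℕ) → ℕ
∑ L f = sum (map f L)
∏ L f = product (map f L)

∑-++ : ∀ (xs ys : List A) f → ∑ (xs ++ ys) f ≡ ∑ xs f + ∑ ys f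
∑-++ xs ys f = trans (cong sum (List.map-++ f xs ys)) (sum-++ (map f xs) (map f ys))

∏-++ : ∀ (xs ys : List A) f → ∏ (xs ++ ys) f ≡ ∏ xs f * ∏ ys f
∏-++ xs ys f = trans (cong product (List.map-++ f xs ys)) (product-++ (map f xs) (map f ys))

∑-cong : ∀ (L : List A) {f g} → (∀ a → f a ≡ g a) → ∑ L f ≡ ∑ L g
∑-cong L e = cong sum (List.map-cong e L)

∏-cong : ∀ (L : List A) {f g} → (∀ a → f a ≡ g a) → ∏ L f ≡ ∏ L g
∏-cong L e = cong product (List.map-cong e L)

∑-cong-∈ : ∀ (L : List A) {f g} → (∀ {a} → a ∈ L → f a ≡ g a) → ∑ L f ≡ ∑ L g
∑-cong-∈ L e = cong sum (List.map-cong-local (All.tabulate e))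

∏-cong-∈ : ∀ (L : List A) {f g} → (∀ {a} → a ∈ L → f a ≡ g a) → ∏ L f ≡ ∏ L g
∏-cong-∈ L e = cong product (List.map-cong-local (All.tabulate e))

∑-zero : ∀ (L : List A) → ∑ L (λ _ → 0) ≡ 0
∑-zero []      = refl
∑-zero (a ∷ L) = ∑-zero L

∏-one : ∀ (L : List A) → ∏ L (λ _ → 1) ≡ 1
∏-one []      = refl
∏-one (a ∷ L) = trans (+-identityʳ _) (∏-one L)

∑-+ : ∀ (L : List A) f g → ∑ L (λ a → f a + g a) ≡ ∑ L f + ∑ L g
∑-+ []      f g = refl
∑-+ (a ∷ L) f g = trans (cong (f a + g a +_) (∑-+ L f g)) (+-interchange (f a) (g a) _ _)

∏-* : ∀ (L : List A) f g → ∏ L (λ a → f a * g a) ≡ ∏ L f * ∏ L g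
∏-* []      f g = refl
∏-* (a ∷ L) f g = trans (cong (f a * g a *_) (∏-* L f g)) (*-interchange (f a) (g a) _ _)

*-∑ : ∀ (L : List A) c f → c * ∑ L f ≡ ∑ L (λ a → c * f a)
*-∑ []      c f = *-zeroʳ c
*-∑ (a ∷ L) c f = trans (*-distribˡ-+ c (f a) (∑ L f)) (cong (c * f a +_) (*-∑ L c f))

∑-* : ∀ (L : List A) c f → ∑ L f * c ≡ ∑ L (λ a → f a * c)
∑-* L c f = trans (*-comm (∑ L f) c) (trans (*-∑ L c f) (∑-cong L (λ a → *-comm c (f a))))

∑-map : ∀ (h : B → A) L (f : A → ℕ) → ∑ (map h L) f ≡ ∑ L (f ∘ h)
∑-map h L f = cong sum (sym (List.map-∘ L))

∏-map : ∀ (h : B → A) L (f : A → ℕ) → ∏ (map h L) f ≡ ∏ L (f ∘ h)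
∏-map h L f = cong product (sym (List.map-∘ L))

∑-concatMap : ∀ (g : B → List A) L (f : A → ℕ) → ∑ (concatMap g L) f ≡ ∑ L (λ b → ∑ (g b) f)
∑-concatMap g []      f = refl
∑-concatMap g (b ∷ L) f = trans (∑-++ (g b) (concatMap g L) f) (cong (∑ (g b) f +_) (∑-concatMap g L f))

∏-concatMap : ∀ (g : B → List A) L (f : A → ℕ) → ∏ (concatMap g L) f ≡ ∏ L (λ b → ∏ (g b) f)
∏-concatMap g []      f = refl
∏-concatMap g (b ∷ L) f = trans (∏-++ (g b) (concatMap g L) f) (cong (∏ (g b) f *_) (∏-concatMap g L f))

∑-swap : ∀ (L : List A) (M : List B) (f : A → B → ℕ) → ∑ L (λ a → ∑ M (f a)) ≡ ∑ M (λ b → ∑ L (λ a → f a b))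
∑-swap []      M f = sym (∑-zero M)
∑-swap (a ∷ L) M f = trans (cong (∑ M (f a) +_) (∑-swap L M f)) (sym (∑-+ M (f a) (λ b → ∑ L (λ a → f a b))))

∏-swap : ∀ (L : List A) (M : List B) (f : A → B → ℕ) → ∏ L (λ a → ∏ M (f a)) ≡ ∏ M (λ b → ∏ L (λ a → f a b))
∏-swap []      M f = sym (∏-one M)
∏-swap (a ∷ L) M f = trans (cong (∏ M (f a) *_) (∏-swap L M f)) (sym (∏-* M (f a) (λ b → ∏ L (λ a → f a b))))

∑-*-∑ : ∀ (L : List A) (M : List B) (f : A → ℕ) (g : B → ℕ) → ∑ L (λ a → ∑ M (λ b → f a * g b)) ≡ ∑ L f * ∑ M g
∑-*-∑ L M f g = trans (∑-cong L (λ a → sym (*-∑ M (f a) g))) (sym (∑-* L (∑ M g) f))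

∑-upTo-suc : ∀ K (f : ℕ → ℕ) → ∑ (upTo (suc K)) f ≡ f 0 + ∑ (upTo K) (f ∘ suc)
∑-upTo-suc K f = cong (f 0 +_) (trans (cong (λ l → ∑ l f) (sym (List.map-upTo suc K))) (∑-map suc (upTo K) f))

∏-upTo-suc : ∀ K (f : ℕ → ℕ) → ∏ (upTo (suc K)) f ≡ f 0 * ∏ (upTo K) (f ∘ suc)
∏-upTo-suc K f = cong (f 0 *_) (trans (cong (λ l → ∏ l f) (sym (List.map-upTo suc K))) (∏-map suc (upTo K) f))

∑-upTo-1 : ∀ K → ∑ (upTo K) (λ _ → 1) ≡ K
∑-upTo-1 zero    = refl
∑-upTo-1 (suc K) = trans (∑-upTo-suc K (λ _ → 1)) (cong suc (∑-upTo-1 K))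

𝟙 : Bool → ℕ
𝟙 b = if b then 1 else 0

δ : ℕ → ℕ → ℕ
δ a b = 𝟙 (a ℕ.≡ᵇ b)

∑-upTo-δ : ∀ {K z} (Q : ℕ → ℕ) → z < K → ∑ (upTo K) (λ c → δ c z * Q c) ≡ Q z
∑-upTo-δ {suc K} {zero}  Q _         =
  trans (∑-upTo-suc K (λ c → δ c 0 * Q c)) (trans (cong₂ _+_ (+-identityʳ (Q 0)) (∑-zero (upTo K))) (+-identityʳ (Q 0)))
∑-upTo-δ {suc K} {suc z} Q (s≤s z<K) = trans (∑-upTo-suc K (λ c → δ c (suc z) * Q c)) (∑-upTo-δ (Q ∘ suc) z<K)

-- Polynomial functions

toℚᵘ-toℚ : ∀ m → ℚ.toℚᵘ (toℚ m) ℚᵘ.≃ mkℚᵘ (ℤ.+ m) 0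
toℚᵘ-toℚ m = toℚᵘ-fromℚᵘ (mkℚᵘ (ℤ.+ m) 0)

toℚ-+ : ∀ a b → toℚ (a + b) ≡ toℚ a ℚ.+ toℚ b
toℚ-+ a b = toℚᵘ-injective (begin
  ℚ.toℚᵘ (toℚ (a + b))                ≈⟨ toℚᵘ-toℚ (a + b) ⟩
  mkℚᵘ (ℤ.+ (a + b)) 0                ≈⟨ *≡* (cong (ℤ._* ℤ.+ 1)
                                           (cong₂ ℤ._+_ (ℤ.*-identityʳ (ℤ.+ a)) (ℤ.*-identityʳ (ℤ.+ b)))) ⟨
  mkℚᵘ (ℤ.+ a) 0 ℚᵘ.+ mkℚᵘ (ℤ.+ b) 0  ≈⟨ ℚᵘ.+-cong (toℚᵘ-toℚ a) (toℚᵘ-toℚ b) ⟨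
  ℚ.toℚᵘ (toℚ a) ℚᵘ.+ ℚ.toℚᵘ (toℚ b)  ≈⟨ toℚᵘ-homo-+ (toℚ a) (toℚ b) ⟨
  ℚ.toℚᵘ (toℚ a ℚ.+ toℚ b)            ∎)
  where open ℚᵘ.≃-Reasoning

toℚ-* : ∀ a b → toℚ (a * b) ≡ toℚ a ℚ.* toℚ b
toℚ-* a b = toℚᵘ-injective (begin
  ℚ.toℚᵘ (toℚ (a * b))                ≈⟨ toℚᵘ-toℚ (a * b) ⟩
  mkℚᵘ (ℤ.+ (a * b)) 0                ≈⟨ *≡* (cong (ℤ._* ℤ.+ 1) (ℤ.pos-* a b)) ⟩
  mkℚᵘ (ℤ.+ a) 0 ℚᵘ.* mkℚᵘ (ℤ.+ b) 0  ≈⟨ ℚᵘ.*-cong (toℚᵘ-toℚ a) (toℚᵘ-toℚ b) ⟨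
  ℚ.toℚᵘ (toℚ a) ℚᵘ.* ℚ.toℚᵘ (toℚ b)  ≈⟨ toℚᵘ-homo-* (toℚ a) (toℚ b) ⟨
  ℚ.toℚᵘ (toℚ a ℚ.* toℚ b)            ∎)
  where open ℚᵘ.≃-Reasoning

record Polynomial {I : Set} (f : (I → ℕ) → ℕ) : Set where
  constructor polynomial
  field
    poly   : Poly I
    agrees : ∀ x → Positive x → toℚ (f x) ≡ evalP x poly

hom-polynomial : {I : Set} {Hs : (I → ℕ) → Graph} → StronglyPolynomial Hs → ∀ G → Polynomial (λ x → hom G (Hs x))
hom-polynomial Hs-poly G = polynomial (proj₁ (Hs-poly G)) (proj₂ (Hs-poly G))

stronglyPolynomial : {I : Set} {Hs : (I → ℕ) → Graph} → (∀ G → Polynomial (λ x → hom G (Hs x))) → StronglyPolynomial Hs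
stronglyPolynomial hom-poly G = Polynomial.poly (hom-poly G) , Polynomial.agrees (hom-poly G)

module _ {I : Set} where

  const-polynomial : ∀ c → Polynomial {I} (λ _ → c)
  const-polynomial c = polynomial (con (toℚ c)) (λ _ _ → refl)

  var-polynomial : ∀ i → Polynomial {I} (λ x → x i)
  var-polynomial i = polynomial (var i) (λ _ _ → refl)

  +-polynomial : ∀ {f g} → Polynomial {I} f → Polynomial g → Polynomial (λ x → f x + g x)
  +-polynomial {f} {g} (polynomial p fp) (polynomial q gq) =
    polynomial (p ⊕ q) (λ x x>0 → trans (toℚ-+ (f x) (g x)) (cong₂ ℚ._+_ (fp x x>0) (gq x x>0)))

  *-polynomial : ∀ {f g} → Polynomial {I} f → Polynomial g → Polynomial (λ x → f x * g x)
  *-polynomial {f} {g} (polynomial p fp) (polynomial q gq) =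
    polynomial (p ⊗ q) (λ x x>0 → trans (toℚ-* (f x) (g x)) (cong₂ ℚ._*_ (fp x x>0) (gq x x>0)))

  polynomial-resp : ∀ {f g} → (∀ x → Positive x → f x ≡ g x) → Polynomial {I} f → Polynomial g
  polynomial-resp f≡g (polynomial p fp) = polynomial p (λ x x>0 → trans (cong toℚ (sym (f≡g x x>0))) (fp x x>0))

  ∑-polynomial : ∀ (L : List A) {f : A → (I → ℕ) → ℕ} →
                 (∀ a → Polynomial (f a)) → Polynomial (λ x → ∑ L (λ a → f a x))
  ∑-polynomial []      f-poly = const-polynomial 0
  ∑-polynomial (a ∷ L) f-poly = +-polynomial (f-poly a) (∑-polynomial L f-poly)

  ∏-polynomial : ∀ (L : List A) {f : A → (I → ℕ) → ℕ} →
                 (∀ a → Polynomial (f a)) → Polynomial (λ x → ∏ L (λ a → f a x))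
  ∏-polynomial []      f-poly = const-polynomial 1
  ∏-polynomial (a ∷ L) f-poly = *-polynomial (f-poly a) (∏-polynomial L f-poly)

mapVars : {I J : Set} → (I → J) → Poly I → Poly J
mapVars r (con q) = con q
mapVars r (var i) = var (r i)
mapVars r (p ⊕ q) = mapVars r p ⊕ mapVars r q
mapVars r (p ⊗ q) = mapVars r p ⊗ mapVars r q

evalP-mapVars : {I J : Set} (r : I → J) (x : J → ℕ) (p : Poly I) → evalP x (mapVars r p) ≡ evalP (x ∘ r) p
evalP-mapVars r x (con q) = refl
evalP-mapVars r x (var i) = refl
evalP-mapVars r x (p ⊕ q) = cong₂ ℚ._+_ (evalP-mapVars r x p) (evalP-mapVars r x q)
evalP-mapVars r x (p ⊗ q) = cong₂ ℚ._*_ (evalP-mapVars r x p) (evalP-mapVars r x q)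

reindex-polynomial : {I J : Set} (r : I → J) {f : (I → ℕ) → ℕ} → Polynomial f → Polynomial (λ x → f (x ∘ r))
reindex-polynomial r (polynomial p fp) =
  polynomial (mapVars r p) (λ x x>0 → trans (fp (x ∘ r) (x>0 ∘ r)) (sym (evalP-mapVars r x p)))

-- Typed equality constraints

_‼_ : List A → ℕ → Maybe A
[]       ‼ i     = nothing
(x ∷ xs) ‼ zero  = just x
(x ∷ xs) ‼ suc i = xs ‼ i

-- Positions out of range read as 0.
_!_ : List ℕ → ℕ → ℕ
xs ! i = fromMaybe 0 (xs ‼ i)

δ-refl : ∀ a → δ a a ≡ 1
δ-refl zero    = refl
δ-refl (suc a) = δ-refl a

δ-sym : ∀ a b → δ a b ≡ δ b a
δ-sym zero    zero    = refl
δ-sym zero    (suc b) = refl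
δ-sym (suc a) zero    = refl
δ-sym (suc a) (suc b) = δ-sym a b

module _ {N : ℕ} (k : Fin N → ℕ) where

  Valid : List (Fin N) → List ℕ → Set
  Valid = Pointwise (λ t c → c < k t)

  ∈-assignments⁻ : ∀ τ {c} → c ∈ assignments k τ → Valid τ c
  ∈-assignments⁻ []      (here refl) = []
  ∈-assignments⁻ (t ∷ τ) c∈
    with c₀ , c₀∈ , c∈′ ← find (∈-concatMap⁻ (λ c₀ → map (c₀ ∷_) (assignments k τ)) {xs = upTo (k t)} c∈)
    with c′ , c′∈ , refl ← ∈-map⁻ (c₀ ∷_) c∈′
    = ∈-upTo⁻ c₀∈ ∷ ∈-assignments⁻ τ c′∈

  Valid-‼ : ∀ {τ c} i {t} → Valid τ c → τ ‼ i ≡ just t → c ! i < k t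
  Valid-‼ zero    (c<k ∷ _) refl = c<k
  Valid-‼ (suc i) (_ ∷ v)   eq   = Valid-‼ i v eq

  ∑-assignments-∷ : ∀ t τ (f : List ℕ → ℕ) →
    ∑ (assignments k (t ∷ τ)) f ≡ ∑ (upTo (k t)) (λ c₀ → ∑ (assignments k τ) (f ∘ (c₀ ∷_)))
  ∑-assignments-∷ t τ f = trans (∑-concatMap (λ c₀ → map (c₀ ∷_) (assignments k τ)) (upTo (k t)) f)
                                (∑-cong (upTo (k t)) (λ c₀ → ∑-map (c₀ ∷_) (assignments k τ) f))

solves : List ℕ → List (ℕ × ℕ) → ℕ
solves c E = ∏ E (λ (i , j) → δ (c ! i) (c ! j))

#solutions : ∀ {N} → (Fin N → ℕ) → List (Fin N) → List (ℕ × ℕ) → ℕ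
#solutions k τ E = ∑ (assignments k τ) (λ c → solves c E)

WellTyped : List A → List (ℕ × ℕ) → Set
WellTyped τ E = All (λ (i , j) → τ ‼ i ≡ τ ‼ j) E

partners₀ : List (ℕ × ℕ) → List ℕ
partners₀ []                    = []
partners₀ ((zero  , zero)  ∷ E) = partners₀ E
partners₀ ((zero  , suc j) ∷ E) = j ∷ partners₀ E
partners₀ ((suc i , zero)  ∷ E) = i ∷ partners₀ E
partners₀ ((suc i , suc j) ∷ E) = partners₀ E

without₀ : List (ℕ × ℕ) → List (ℕ × ℕ)
without₀ []                    = []
without₀ ((zero  , zero)  ∷ E) = without₀ E
without₀ ((zero  , suc j) ∷ E) = without₀ E
without₀ ((suc i , zero)  ∷ E) = without₀ E
without₀ ((suc i , suc j) ∷ E) = (i , j) ∷ without₀ E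

solves-∷ : ∀ c₀ c E → solves (c₀ ∷ c) E ≡ ∏ (partners₀ E) (δ c₀ ∘ (c !_)) * solves c (without₀ E)
solves-∷ c₀ c []                    = refl
solves-∷ c₀ c ((zero  , zero)  ∷ E) =
  trans (cong (_* solves (c₀ ∷ c) E) (δ-refl c₀)) (trans (*-identityˡ _) (solves-∷ c₀ c E))
solves-∷ c₀ c ((zero  , suc j) ∷ E) =
  trans (cong (δ c₀ (c ! j) *_) (solves-∷ c₀ c E)) (sym (*-assoc (δ c₀ (c ! j)) _ _))
solves-∷ c₀ c ((suc i , zero)  ∷ E) =
  trans (cong₂ _*_ (δ-sym (c ! i) c₀) (solves-∷ c₀ c E)) (sym (*-assoc (δ c₀ (c ! i)) _ _))
solves-∷ c₀ c ((suc i , suc j) ∷ E) =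
  trans (cong (δ (c ! i) (c ! j) *_) (solves-∷ c₀ c E))
        (*-exchangeˡ (δ (c ! i) (c ! j)) (∏ (partners₀ E) (δ c₀ ∘ (c !_))) (solves c (without₀ E)))

solves-++ : ∀ c y ys E → solves c (map (y ,_) ys ++ E) ≡ ∏ (map (c !_) ys) (δ (c ! y)) * solves c E
solves-++ c y ys E = trans (∏-++ (map (y ,_) ys) E _)
  (cong (_* solves c E) (trans (∏-map (y ,_) ys _) (sym (∏-map (c !_) ys (δ (c ! y))))))

module _ {t : A} {τ : List A} where

  partners₀-typed : ∀ E → WellTyped (t ∷ τ) E → All (λ y → τ ‼ y ≡ just t) (partners₀ E)
  partners₀-typed []                    []       = []
  partners₀-typed ((zero  , zero)  ∷ E) (_ ∷ wt) = partners₀-typed E wt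
  partners₀-typed ((zero  , suc j) ∷ E) (e ∷ wt) = sym e ∷ partners₀-typed E wt
  partners₀-typed ((suc i , zero)  ∷ E) (e ∷ wt) = e ∷ partners₀-typed E wt
  partners₀-typed ((suc i , suc j) ∷ E) (_ ∷ wt) = partners₀-typed E wt

  without₀-typed : ∀ E → WellTyped (t ∷ τ) E → WellTyped τ (without₀ E)
  without₀-typed []                    []       = []
  without₀-typed ((zero  , zero)  ∷ E) (_ ∷ wt) = without₀-typed E wt
  without₀-typed ((zero  , suc j) ∷ E) (_ ∷ wt) = without₀-typed E wt
  without₀-typed ((suc i , zero)  ∷ E) (_ ∷ wt) = without₀-typed E wt
  without₀-typed ((suc i , suc j) ∷ E) (e ∷ wt) = e ∷ without₀-typed E wt

#agreeing : ℕ → List ℕ → ℕ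
#agreeing K vs = ∑ (upTo K) (λ c₀ → ∏ vs (δ c₀))

#agreeing-∷ : ∀ {K v} vs → v < K → #agreeing K (v ∷ vs) ≡ ∏ vs (δ v)
#agreeing-∷ vs = ∑-upTo-δ (λ c₀ → ∏ vs (δ c₀))

#solutions-∷ : ∀ {N} (k : Fin N → ℕ) t τ E → #solutions k (t ∷ τ) E ≡
  ∑ (assignments k τ) (λ c → #agreeing (k t) (map (c !_) (partners₀ E)) * solves c (without₀ E))
#solutions-∷ k t τ E = begin
  #solutions k (t ∷ τ) E
    ≡⟨ ∑-assignments-∷ k t τ (λ c → solves c E) ⟩
  ∑ (upTo (k t)) (λ c₀ → ∑ (assignments k τ) (λ c → solves (c₀ ∷ c) E))
    ≡⟨ ∑-swap (upTo (k t)) (assignments k τ) (λ c₀ c → solves (c₀ ∷ c) E) ⟩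
  ∑ (assignments k τ) (λ c → ∑ (upTo (k t)) (λ c₀ → solves (c₀ ∷ c) E))
    ≡⟨ ∑-cong (assignments k τ) (λ c → ∑-cong (upTo (k t)) (λ c₀ →
         trans (solves-∷ c₀ c E) (cong (_* solves c (without₀ E)) (sym (∏-map (c !_) (partners₀ E) (δ c₀)))))) ⟩
  ∑ (assignments k τ) (λ c → ∑ (upTo (k t)) (λ c₀ → ∏ (map (c !_) (partners₀ E)) (δ c₀) * solves c (without₀ E)))
    ≡⟨ ∑-cong (assignments k τ) (λ c → sym (∑-* (upTo (k t)) _ _)) ⟩
  ∑ (assignments k τ) (λ c → #agreeing (k t) (map (c !_) (partners₀ E)) * solves c (without₀ E)) ∎
  where open ≡-Reasoning

-- Eliminating the first variable either frees it (a factor k t) or substitutes it by one of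
-- its partners, which keeps the constraints well typed.
#solutions-polynomial : ∀ {N} (τ : List (Fin N)) E → WellTyped τ E → Polynomial (λ k → #solutions k τ E)
#solutions-polynomial []      E _  = const-polynomial (solves [] E + 0)
#solutions-polynomial (t ∷ τ) E wt =
  polynomial-resp (λ k _ → sym (#solutions-∷ k t τ E))
    (eliminate (partners₀ E) (partners₀-typed E wt) (without₀-typed E wt))
  where
  eliminate : ∀ ys → All (λ y → τ ‼ y ≡ just t) ys → WellTyped τ (without₀ E) →
    Polynomial (λ k → ∑ (assignments k τ) (λ c → #agreeing (k t) (map (c !_) ys) * solves c (without₀ E)))
  eliminate [] _ wt′ =
    polynomial-resp (λ k _ → trans (*-∑ (assignments k τ) (k t) _)
                                   (∑-cong (assignments k τ) (λ c → cong (_* solves c (without₀ E)) (sym (∑-upTo-1 (k t))))))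
      (*-polynomial (var-polynomial t) (#solutions-polynomial τ (without₀ E) wt′))
  eliminate (y ∷ ys) (y∶t ∷ ys∶t) wt′ =
    polynomial-resp (λ k _ → ∑-cong-∈ (assignments k τ) (λ {c} c∈ →
        trans (solves-++ c y ys (without₀ E))
              (cong (_* solves c (without₀ E))
                    (sym (#agreeing-∷ (map (c !_) ys) (Valid-‼ k y (∈-assignments⁻ k τ c∈) y∶t))))))
      (#solutions-polynomial τ (map (y ,_) ys ++ without₀ E)
         (++⁺ (map⁺ (All.map (λ y′∶t → trans y∶t (sym y′∶t)) ys∶t)) wt′))

-- Paths to the root

iter-+ : ∀ (f : A → A) m n a → iter f (m + n) a ≡ iter f m (iter f n a)
iter-+ f zero    n a = refl
iter-+ f (suc m) n a = cong f (iter-+ f m n a)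

iter-suc : ∀ (f : A → A) d a → iter f (suc d) a ≡ iter f d (f a)
iter-suc f d a = trans (cong (λ d → iter f d a) (+-comm 1 d)) (iter-+ f d 1 a)

module _ {N : ℕ} (T : RootedTree N) where

  private
    p = parent T
    r = root T

  iter-root : ∀ d → iter p d r ≡ r
  iter-root zero    = refl
  iter-root (suc d) = trans (cong p (iter-root d)) (parent-root T)

  stays-at-root : ∀ s {i d} → iter p i s ≡ r → i ≤ d → iter p d s ≡ r
  stays-at-root s {i} {d} e i≤d = begin
    iter p d s                 ≡⟨ cong (λ d → iter p d s) (m∸n+n≡m i≤d) ⟨
    iter p (d ∸ i + i) s       ≡⟨ iter-+ p (d ∸ i) i s ⟩
    iter p (d ∸ i) (iter p i s) ≡⟨ cong (iter p (d ∸ i)) e ⟩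
    iter p (d ∸ i) r           ≡⟨ iter-root (d ∸ i) ⟩
    r                          ∎
    where open ≡-Reasoning

  IsDepth : Fin N → ℕ → Set
  IsDepth s D = iter p D s ≡ r × (∀ {i} → i < D → ¬ iter p i s ≡ r)

  depth : ∀ s → ∃ (IsDepth s)
  depth s = below (proj₁ (reaches T s)) (proj₂ (reaches T s))
    where
    below : ∀ d → iter p d s ≡ r → ∃ (IsDepth s)
    below zero    e = 0 , e , λ ()
    below (suc d) e with iter p d s ≟ r
    ... | yes e′ = below d e′
    ... | no  ne = suc d , e , λ i<1+d e′ → ne (stays-at-root s e′ (≤-pred i<1+d))

  -- Among s, p s, …, p^D s two coincide once D ≥ N, and cutting out the cycle
  -- between them reaches the root in fewer than D steps.
  depth<N : ∀ {s D} → IsDepth s D → D < N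
  depth<N {s} {D} (s→r , minimal) with D <? N
  ... | yes D<N = D<N
  ... | no  D≮N with i , j , i<j , same ← Fin.pigeonhole (≰⇒> D≮N) (λ (i : Fin (suc D)) → iter p (toℕ i) s)
    = ⊥-elim (minimal shortcut< shortcut)
    where
    j≤D : toℕ j ≤ D
    j≤D = ≤-pred (Fin.toℕ<n j)
    shortcut< : toℕ i + (D ∸ toℕ j) < D
    shortcut< = subst (toℕ i + (D ∸ toℕ j) <_) (m+[n∸m]≡n j≤D) (+-monoˡ-< (D ∸ toℕ j) i<j)
    shortcut : iter p (toℕ i + (D ∸ toℕ j)) s ≡ r
    shortcut = begin
      iter p (toℕ i + (D ∸ toℕ j)) s      ≡⟨ cong (λ d → iter p d s) (+-comm (toℕ i) (D ∸ toℕ j)) ⟩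
      iter p (D ∸ toℕ j + toℕ i) s        ≡⟨ iter-+ p (D ∸ toℕ j) (toℕ i) s ⟩
      iter p (D ∸ toℕ j) (iter p (toℕ i) s) ≡⟨ cong (iter p (D ∸ toℕ j)) same ⟩
      iter p (D ∸ toℕ j) (iter p (toℕ j) s) ≡⟨ iter-+ p (D ∸ toℕ j) (toℕ j) s ⟨
      iter p (D ∸ toℕ j + toℕ j) s        ≡⟨ cong (λ d → iter p d s) (m∸n+n≡m j≤D) ⟩
      iter p D s                          ≡⟨ s→r ⟩
      r                                   ∎
      where open ≡-Reasoning

  pathFrom-fuel : ∀ D {f} s → iter p D s ≡ r → D ≤ f → pathFrom T f s ≡ pathFrom T D s
  pathFrom-fuel zero    {zero}  s _   _ = refl
  pathFrom-fuel zero    {suc f} s s≡r _ with s ≟ r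
  ... | yes _   = refl
  ... | no  s≢r = ⊥-elim (s≢r s≡r)
  pathFrom-fuel (suc D) {suc f} s e (s≤s D≤f) with s ≟ r
  ... | yes _ = refl
  ... | no  _ = cong (s ∷_) (pathFrom-fuel D (p s) (trans (sym (iter-suc p D s)) e) D≤f)

  pathFrom-iter : ∀ d f s → (∀ {i} → i < d → ¬ iter p i s ≡ r) →
    ∃ λ pre → length pre ≡ d × pathFrom T (d + f) s ≡ pre ++ pathFrom T f (iter p d s)
  pathFrom-iter zero    f s _       = [] , refl , refl
  pathFrom-iter (suc d) f s no-root with s ≟ r
  ... | yes s≡r = ⊥-elim (no-root z<s s≡r)
  ... | no  _
    with pre , len , eq ← pathFrom-iter d f (p s) (λ {i} i<d → no-root (s<s i<d) ∘ trans (iter-suc p i s))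
    = s ∷ pre , cong suc len , cong (s ∷_) (trans eq (cong (λ u → pre ++ pathFrom T f u) (sym (iter-suc p d s))))

  P-iter : ∀ {s D} → IsDepth s D → ∀ {d} → d ≤ D →
    ∃ λ pre → length pre ≡ d × P T s ≡ pre ++ P T (iter p d s)
  P-iter {s} {D} D-depth@(s→r , minimal) {d} d≤D
    with pre , len , eq ← pathFrom-iter d (N ∸ d) s (λ i<d → minimal (<-≤-trans i<d d≤D))
    = pre , len , (begin
      pathFrom T N s                         ≡⟨ cong (λ f → pathFrom T f s) (m+[n∸m]≡n d≤N) ⟨
      pathFrom T (d + (N ∸ d)) s             ≡⟨ eq ⟩
      pre ++ pathFrom T (N ∸ d) t            ≡⟨ cong (pre ++_) (pathFrom-fuel (D ∸ d) t t→r (∸-monoˡ-≤ d D≤N)) ⟩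
      pre ++ pathFrom T (D ∸ d) t            ≡⟨ cong (pre ++_) (pathFrom-fuel (D ∸ d) t t→r (≤-trans (m∸n≤m D d) D≤N)) ⟨
      pre ++ pathFrom T N t                  ∎)
    where
    open ≡-Reasoning
    t = iter p d s
    D≤N : D ≤ N
    D≤N = <⇒≤ (depth<N D-depth)
    d≤N : d ≤ N
    d≤N = ≤-trans d≤D D≤N
    t→r : iter p (D ∸ d) t ≡ r
    t→r = trans (sym (iter-+ p (D ∸ d) d s)) (trans (cong (λ d → iter p d s) (m∸n+n≡m d≤D)) s→r)

  within-depth : ∀ {s D d t} → IsDepth s D → iter p d s ≡ t → ∃ λ d′ → d′ ≤ D × iter p d′ s ≡ t
  within-depth {s} {D} {d} (s→r , _) s→t with d ≤? D
  ... | yes d≤D = d , d≤D , s→t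
  ... | no  d≰D = D , ≤-refl , trans s→r (trans (sym (stays-at-root s s→r (<⇒≤ (≰⇒> d≰D)))) s→t)

  P-ancestor : ∀ {s t} → Ancestor T t s → ∃ λ pre → 0 < length pre × P T s ≡ pre ++ P T t
  P-ancestor {s} {t} (t≢s , d , s→t) with D , D-depth ← depth s with within-depth {d = d} D-depth s→t
  ... | zero  , _   , refl = ⊥-elim (t≢s refl)
  ... | suc _ , d≤D , refl with pre , len , eq ← P-iter D-depth d≤D = pre , subst (0 <_) (sym len) z<s , eq

tuples : ∀ n → List A → List (Vec A n)
tuples zero    L = [ [] ]
tuples (suc n) L = concatMap (λ w → map (_∷ w) L) (tuples n L)

tuplesD : (B → List A) → Vec B m → List (Vec A m)
tuplesD M []      = [ [] ]
tuplesD M (b ∷ σ) = concatMap (λ w → map (_∷ w) (M b)) (tuplesD M σ)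

∑-tuples-suc : ∀ n (L : List A) g → ∑ (tuples (suc n) L) g ≡ ∑ (tuples n L) (λ w → ∑ L (λ a → g (a ∷ w)))
∑-tuples-suc n L g = trans (∑-concatMap (λ w → map (_∷ w) L) (tuples n L) g)
                           (∑-cong (tuples n L) (λ w → ∑-map (_∷ w) L g))

∑-tuplesD-∷ : ∀ (M : B → List A) b (σ : Vec B m) g →
  ∑ (tuplesD M (b ∷ σ)) g ≡ ∑ (tuplesD M σ) (λ w → ∑ (M b) (λ a → g (a ∷ w)))
∑-tuplesD-∷ M b σ g = trans (∑-concatMap (λ w → map (_∷ w) (M b)) (tuplesD M σ) g)
                            (∑-cong (tuplesD M σ) (λ w → ∑-map (_∷ w) (M b) g))

allMaps≡tuples : ∀ n m → allMaps n m ≡ tuples n (allFin m)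
allMaps≡tuples zero    m = refl
allMaps≡tuples (suc n) m = cong (concatMap (λ w → map (_∷ w) (allFin m))) (allMaps≡tuples n m)

∑-tuples-map : ∀ n (L : List A) (h : A → B) g → ∑ (tuples n L) (g ∘ Vec.map h) ≡ ∑ (tuples n (map h L)) g
∑-tuples-map zero    L h g = refl
∑-tuples-map (suc n) L h g = begin
  ∑ (tuples (suc n) L) (g ∘ Vec.map h)                       ≡⟨ ∑-tuples-suc n L _ ⟩
  ∑ (tuples n L) (λ w → ∑ L (λ a → g (h a ∷ Vec.map h w)))   ≡⟨ ∑-cong (tuples n L) (λ w → ∑-map h L _) ⟨
  ∑ (tuples n L) (λ w → ∑ (map h L) (λ b → g (b ∷ Vec.map h w))) ≡⟨ ∑-tuples-map n L h _ ⟩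
  ∑ (tuples n (map h L)) (λ u → ∑ (map h L) (λ b → g (b ∷ u))) ≡⟨ ∑-tuples-suc n (map h L) g ⟨
  ∑ (tuples (suc n) (map h L)) g                             ∎
  where open ≡-Reasoning

∑-tuples-concatMap : ∀ n (L : List B) (M : B → List A) g →
  ∑ (tuples n (concatMap M L)) g ≡ ∑ (tuples n L) (λ σ → ∑ (tuplesD M σ) g)
∑-tuples-concatMap zero    L M g = sym (+-identityʳ _)
∑-tuples-concatMap (suc n) L M g = begin
  ∑ (tuples (suc n) (concatMap M L)) g
    ≡⟨ ∑-tuples-suc n (concatMap M L) g ⟩
  ∑ (tuples n (concatMap M L)) (λ w → ∑ (concatMap M L) (λ a → g (a ∷ w)))
    ≡⟨ ∑-tuples-concatMap n L M _ ⟩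
  ∑ (tuples n L) (λ σ → ∑ (tuplesD M σ) (λ w → ∑ (concatMap M L) (λ a → g (a ∷ w))))
    ≡⟨ ∑-cong (tuples n L) (λ σ → trans (∑-cong (tuplesD M σ) (λ w → ∑-concatMap M L _)) (∑-swap (tuplesD M σ) L _)) ⟩
  ∑ (tuples n L) (λ σ → ∑ L (λ b → ∑ (tuplesD M σ) (λ w → ∑ (M b) (λ a → g (a ∷ w)))))
    ≡⟨ ∑-cong (tuples n L) (λ σ → ∑-cong L (λ b → ∑-tuplesD-∷ M b σ g)) ⟨
  ∑ (tuples n L) (λ σ → ∑ L (λ b → ∑ (tuplesD M (b ∷ σ)) g))
    ≡⟨ ∑-tuples-suc n L _ ⟨
  ∑ (tuples (suc n) L) (λ σ → ∑ (tuplesD M σ) g) ∎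
  where open ≡-Reasoning

zipWith₃ : (A → B → C → D) → Vec A m → Vec B m → Vec C m → Vec D m
zipWith₃ f []      []      []      = []
zipWith₃ f (a ∷ σ) (b ∷ φ) (c ∷ v) = f a b c ∷ zipWith₃ f σ φ v

lookup-zipWith₃ : ∀ (f : A → B → C → D) σ φ v (i : Fin m) →
  Vec.lookup (zipWith₃ f σ φ v) i ≡ f (Vec.lookup σ i) (Vec.lookup φ i) (Vec.lookup v i)
lookup-zipWith₃ f (a ∷ σ) (b ∷ φ) (c ∷ v) Fin.zero    = refl
lookup-zipWith₃ f (a ∷ σ) (b ∷ φ) (c ∷ v) (Fin.suc i) = lookup-zipWith₃ f σ φ v i

∑-tuplesD-product : ∀ (σ : Vec A m) (Φ : A → List B) (V : A → List C) (f : A → B → C → D) g →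
  ∑ (tuplesD (λ a → concatMap (λ b → map (f a b) (V a)) (Φ a)) σ) g ≡
  ∑ (tuplesD Φ σ) (λ φ → ∑ (tuplesD V σ) (λ v → g (zipWith₃ f σ φ v)))
∑-tuplesD-product []      Φ V f g = sym (+-identityʳ _)
∑-tuplesD-product (a ∷ σ) Φ V f g = begin
  ∑ (tuplesD M (a ∷ σ)) g
    ≡⟨ ∑-tuplesD-∷ M a σ g ⟩
  ∑ (tuplesD M σ) (λ w → ∑ (M a) (λ d → g (d ∷ w)))
    ≡⟨ ∑-cong (tuplesD M σ) (λ w → trans (∑-concatMap (λ b → map (f a b) (V a)) (Φ a) _)
                                        (∑-cong (Φ a) (λ b → ∑-map (f a b) (V a) _))) ⟩
  ∑ (tuplesD M σ) (λ w → ∑ (Φ a) (λ b → ∑ (V a) (λ c → g (f a b c ∷ w))))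
    ≡⟨ ∑-tuplesD-product σ Φ V f _ ⟩
  ∑ (tuplesD Φ σ) (λ φ → ∑ (tuplesD V σ) (λ v → ∑ (Φ a) (λ b → ∑ (V a) (λ c → g (f a b c ∷ zipWith₃ f σ φ v)))))
    ≡⟨ ∑-cong (tuplesD Φ σ) (λ φ → ∑-swap (tuplesD V σ) (Φ a) _) ⟩
  ∑ (tuplesD Φ σ) (λ φ → ∑ (Φ a) (λ b → ∑ (tuplesD V σ) (λ v → ∑ (V a) (λ c → g (f a b c ∷ zipWith₃ f σ φ v)))))
    ≡⟨ ∑-cong (tuplesD Φ σ) (λ φ → ∑-cong (Φ a) (λ b → ∑-tuplesD-∷ V a σ _)) ⟨
  ∑ (tuplesD Φ σ) (λ φ → ∑ (Φ a) (λ b → ∑ (tuplesD V (a ∷ σ)) (λ v → g (zipWith₃ f (a ∷ σ) (b ∷ φ) v))))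
    ≡⟨ ∑-tuplesD-∷ Φ a σ _ ⟨
  ∑ (tuplesD Φ (a ∷ σ)) (λ φ → ∑ (tuplesD V (a ∷ σ)) (λ v → g (zipWith₃ f (a ∷ σ) φ v))) ∎
  where
  open ≡-Reasoning
  M = λ a → concatMap (λ b → map (f a b) (V a)) (Φ a)

‼-++ˡ : ∀ (xs ys : List A) {i} → i < length xs → (xs ++ ys) ‼ i ≡ xs ‼ i
‼-++ˡ (x ∷ xs) ys {zero}  _         = refl
‼-++ˡ (x ∷ xs) ys {suc i} (s<s i<n) = ‼-++ˡ xs ys i<n

‼-++ʳ : ∀ (xs ys : List A) i → (xs ++ ys) ‼ (length xs + i) ≡ ys ‼ i
‼-++ʳ []       ys i = refl
‼-++ʳ (x ∷ xs) ys i = ‼-++ʳ xs ys i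

‼-suffix : ∀ (xs ys : List A) i → (xs ++ ys) ‼ (length (xs ++ ys) ∸ length ys + i) ≡ ys ‼ i
‼-suffix xs ys i = trans (cong (λ d → (xs ++ ys) ‼ (d + i)) (trans (cong (_∸ length ys) (List.length-++ xs))
                                                                  (m+n∸n≡m (length xs) (length ys))))
                         (‼-++ʳ xs ys i)

drop-‼ : ∀ d (xs : List A) i → List.drop d xs ‼ i ≡ xs ‼ (d + i)
drop-‼ zero    xs       i = refl
drop-‼ (suc d) []       i = refl
drop-‼ (suc d) (x ∷ xs) i = drop-‼ d xs i

offset : (B → ℕ) → Vec B m → Fin m → ℕ
offset ℓ (b ∷ σ) Fin.zero    = 0
offset ℓ (b ∷ σ) (Fin.suc u) = ℓ b + offset ℓ σ u

concat-‼ : ∀ (ℓ : B → ℕ) σ (xss : Vec (List A) m) → (∀ w → length (Vec.lookup xss w) ≡ ℓ (Vec.lookup σ w)) →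
  ∀ u {i} → i < ℓ (Vec.lookup σ u) → List.concat (Vec.toList xss) ‼ (offset ℓ σ u + i) ≡ Vec.lookup xss u ‼ i
concat-‼ ℓ (b ∷ σ) (xs ∷ xss) lengths Fin.zero    i<ℓ =
  ‼-++ˡ xs _ (subst (_ <_) (sym (lengths Fin.zero)) i<ℓ)
concat-‼ ℓ (b ∷ σ) (xs ∷ xss) lengths (Fin.suc u) {i} i<ℓ = begin
  (xs ++ rest) ‼ (ℓ b + offset ℓ σ u + i)        ≡⟨ cong (λ d → (xs ++ rest) ‼ (d + offset ℓ σ u + i)) (lengths Fin.zero) ⟨
  (xs ++ rest) ‼ (length xs + offset ℓ σ u + i)  ≡⟨ cong ((xs ++ rest) ‼_) (+-assoc (length xs) _ i) ⟩
  (xs ++ rest) ‼ (length xs + (offset ℓ σ u + i)) ≡⟨ ‼-++ʳ xs rest _ ⟩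
  rest ‼ (offset ℓ σ u + i)                      ≡⟨ concat-‼ ℓ σ xss (lengths ∘ Fin.suc) u i<ℓ ⟩
  Vec.lookup xss u ‼ i                           ∎
  where
  open ≡-Reasoning
  rest = List.concat (Vec.toList xss)

∈-tuplesD⁻ : ∀ (M : B → List A) (σ : Vec B m) {φ} → φ ∈ tuplesD M σ → ∀ u → Vec.lookup φ u ∈ M (Vec.lookup σ u)
∈-tuplesD⁻ M (b ∷ σ) φ∈
  with w , w∈ , φ∈′ ← find (∈-concatMap⁻ (λ w → map (_∷ w) (M b)) {xs = tuplesD M σ} φ∈)
  with a , a∈ , refl ← ∈-map⁻ (_∷ w) φ∈′
  = λ { Fin.zero → a∈ ; (Fin.suc u) → ∈-tuplesD⁻ M σ w∈ u }

module _ {N : ℕ} (k : Fin N → ℕ) where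

  ∑-assignments-++ : ∀ xs ys (g : List ℕ → ℕ) →
    ∑ (assignments k (xs ++ ys)) g ≡ ∑ (assignments k xs) (λ a → ∑ (assignments k ys) (λ b → g (a ++ b)))
  ∑-assignments-++ []       ys g = sym (+-identityʳ _)
  ∑-assignments-++ (t ∷ xs) ys g = begin
    ∑ (assignments k (t ∷ xs ++ ys)) g
      ≡⟨ ∑-assignments-∷ k t (xs ++ ys) g ⟩
    ∑ (upTo (k t)) (λ c₀ → ∑ (assignments k (xs ++ ys)) (g ∘ (c₀ ∷_)))
      ≡⟨ ∑-cong (upTo (k t)) (λ c₀ → ∑-assignments-++ xs ys (g ∘ (c₀ ∷_))) ⟩
    ∑ (upTo (k t)) (λ c₀ → ∑ (assignments k xs) (λ a → ∑ (assignments k ys) (λ b → g (c₀ ∷ a ++ b))))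
      ≡⟨ ∑-assignments-∷ k t xs _ ⟨
    ∑ (assignments k (t ∷ xs)) (λ a → ∑ (assignments k ys) (λ b → g (a ++ b))) ∎
    where open ≡-Reasoning

  ∑-tuplesD-assignments : ∀ (τ : B → List (Fin N)) (σ : Vec B m) g →
    ∑ (tuplesD (assignments k ∘ τ) σ) (g ∘ List.concat ∘ Vec.toList) ≡
    ∑ (assignments k (List.concat (Vec.toList (Vec.map τ σ)))) g
  ∑-tuplesD-assignments τ []      g = refl
  ∑-tuplesD-assignments τ (b ∷ σ) g = begin
    ∑ (tuplesD (assignments k ∘ τ) (b ∷ σ)) (g ∘ List.concat ∘ Vec.toList)
      ≡⟨ ∑-tuplesD-∷ (assignments k ∘ τ) b σ _ ⟩
    ∑ (tuplesD (assignments k ∘ τ) σ) (λ r → ∑ (assignments k (τ b)) (λ a → g (a ++ List.concat (Vec.toList r))))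
      ≡⟨ ∑-swap (tuplesD (assignments k ∘ τ) σ) (assignments k (τ b)) _ ⟩
    ∑ (assignments k (τ b)) (λ a → ∑ (tuplesD (assignments k ∘ τ) σ) (λ r → g (a ++ List.concat (Vec.toList r))))
      ≡⟨ ∑-cong (assignments k (τ b)) (λ a → ∑-tuplesD-assignments τ σ (g ∘ (a ++_))) ⟩
    ∑ (assignments k (τ b)) (λ a → ∑ (assignments k (List.concat (Vec.toList (Vec.map τ σ)))) (λ c → g (a ++ c)))
      ≡⟨ ∑-assignments-++ (τ b) _ g ⟨
    ∑ (assignments k (τ b ++ List.concat (Vec.toList (Vec.map τ σ)))) g ∎
    where open ≡-Reasoning

𝟙-∧ : ∀ a b → 𝟙 (a ∧ b) ≡ 𝟙 a * 𝟙 b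
𝟙-∧ true  b = sym (+-identityʳ _)
𝟙-∧ false b = refl

𝟙-≡ : ∀ (p q : List ℕ) → length p ≡ length q → 𝟙 ⌊ ≡-dec _≟ℕ_ p q ⌋ ≡ ∏ (upTo (length q)) (λ i → δ (p ! i) (q ! i))
𝟙-≡ []      []      _  = refl
𝟙-≡ (x ∷ p) (y ∷ q) eq = begin
  𝟙 ⌊ ≡-dec _≟ℕ_ (x ∷ p) (y ∷ q) ⌋                 ≡⟨ cong 𝟙 (isYes≗does (≡-dec _≟ℕ_ (x ∷ p) (y ∷ q))) ⟩
  𝟙 ((x ℕ.≡ᵇ y) ∧ does (≡-dec _≟ℕ_ p q))          ≡⟨ 𝟙-∧ (x ℕ.≡ᵇ y) _ ⟩
  δ x y * 𝟙 (does (≡-dec _≟ℕ_ p q))               ≡⟨ cong (λ b → δ x y * 𝟙 b) (isYes≗does (≡-dec _≟ℕ_ p q)) ⟨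
  δ x y * 𝟙 ⌊ ≡-dec _≟ℕ_ p q ⌋                    ≡⟨ cong (δ x y *_) (𝟙-≡ p q (suc-injective eq)) ⟩
  δ x y * ∏ (upTo (length q)) (λ i → δ (p ! i) (q ! i)) ≡⟨ ∏-upTo-suc (length q) (λ i → δ ((x ∷ p) ! i) ((y ∷ q) ! i)) ⟨
  ∏ (upTo (suc (length q))) (λ i → δ ((x ∷ p) ! i) ((y ∷ q) ! i)) ∎
  where open ≡-Reasoning

restrictsTo-refl : ∀ p → restrictsTo p p ≡ true
restrictsTo-refl p rewrite n∸n≡0 (length p) = trans (isYes≗does (≡-dec _≟ℕ_ p p)) (dec-true (≡-dec _≟ℕ_ p p) refl)

restrictsTo-∨ : ∀ p q → length q ≤ length p → (restrictsTo p q ∨ restrictsTo q p) ≡ restrictsTo p q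
restrictsTo-∨ p q q≤p rewrite m≤n⇒m∸n≡0 q≤p with ≡-dec _≟ℕ_ q p
... | yes refl = trans (∨-zeroʳ _) (sym (restrictsTo-refl p))
... | no  _    = ∨-identityʳ _

𝟙-restrictsTo : ∀ p q → length q ≤ length p →
  𝟙 (restrictsTo p q ∨ restrictsTo q p) ≡ ∏ (upTo (length q)) (λ i → δ (p ! (length p ∸ length q + i)) (q ! i))
𝟙-restrictsTo p q q≤p = begin
  𝟙 (restrictsTo p q ∨ restrictsTo q p)                     ≡⟨ cong 𝟙 (restrictsTo-∨ p q q≤p) ⟩
  𝟙 ⌊ ≡-dec _≟ℕ_ (List.drop d p) q ⌋                        ≡⟨ 𝟙-≡ (List.drop d p) q length-drop ⟩
  ∏ (upTo (length q)) (λ i → δ (List.drop d p ! i) (q ! i))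
    ≡⟨ ∏-cong (upTo (length q)) (λ i → cong (λ a → δ (fromMaybe 0 a) (q ! i)) (drop-‼ d p i)) ⟩
  ∏ (upTo (length q)) (λ i → δ (p ! (d + i)) (q ! i))       ∎
  where
  open ≡-Reasoning
  d = length p ∸ length q
  length-drop : length (List.drop d p) ≡ length q
  length-drop = trans (List.length-drop d p) (m∸[m∸n]≡n q≤p)

weight : (G : MGraph) → (A → A → ℕ) → Vec A (n G) → ℕ
weight G w φ = ∏ (edges G) (λ (u , v) → w (Vec.lookup φ u) (Vec.lookup φ v))

weight-map : ∀ G (w : B → B → ℕ) (h : A → B) φ → weight G w (Vec.map h φ) ≡ weight G (λ a b → w (h a) (h b)) φ
weight-map G w h φ = ∏-cong (edges G) (λ (u , v) → cong₂ w (Vec.lookup-map u h φ) (Vec.lookup-map v h φ))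

map-lookup-allFin : ∀ (L : List A) → map (List.lookup L) (allFin (length L)) ≡ L
map-lookup-allFin L = trans (List.map-tabulate (λ i → i) (List.lookup L)) (List.tabulate-lookup L)

hom-listed : ∀ G (L : List A) (w : A → A → ℕ) →
  hom G (record { size = length L ; adj = λ a b → w (List.lookup L a) (List.lookup L b) }) ≡
  ∑ (tuples (n G) L) (weight G w)
hom-listed G L w = begin
  ∑ (allMaps (n G) (length L)) (weight G (λ a b → w (List.lookup L a) (List.lookup L b)))
    ≡⟨ ∑-cong (allMaps (n G) (length L)) (λ φ → weight-map G w (List.lookup L) φ) ⟨
  ∑ (allMaps (n G) (length L)) (weight G w ∘ Vec.map (List.lookup L))
    ≡⟨ cong (λ M → ∑ M (weight G w ∘ Vec.map (List.lookup L))) (allMaps≡tuples (n G) (length L)) ⟩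
  ∑ (tuples (n G) (allFin (length L))) (weight G w ∘ Vec.map (List.lookup L))
    ≡⟨ ∑-tuples-map (n G) (allFin (length L)) (List.lookup L) (weight G w) ⟩
  ∑ (tuples (n G) (map (List.lookup L) (allFin (length L)))) (weight G w)
    ≡⟨ cong (λ M → ∑ (tuples (n G) M) (weight G w)) (map-lookup-allFin L) ⟩
  ∑ (tuples (n G) L) (weight G w) ∎
  where open ≡-Reasoning

weight₂ : (G : MGraph) → (A → B → A → B → ℕ) → Vec A (n G) → Vec B (n G) → ℕ
weight₂ G w σ φ = ∏ (edges G) (λ (u , v) → w (Vec.lookup σ u) (Vec.lookup φ u) (Vec.lookup σ v) (Vec.lookup φ v))

triple : A → B → C → A × B × C
triple a b c = a , b , c

weight-zipWith₃ : ∀ G (w₁ : A → B → A → B → ℕ) (w₂ : A → C → A → C → ℕ) σ φ v →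
  weight G (λ (s , φ , a) (t , ψ , b) → w₁ s φ t ψ * w₂ s a t b) (zipWith₃ triple σ φ v) ≡
  weight₂ G w₁ σ φ * weight₂ G w₂ σ v
weight-zipWith₃ G w₁ w₂ σ φ v =
  trans (∏-cong (edges G) (λ (u , u′) → cong₂ w (lookup-zipWith₃ triple σ φ v u) (lookup-zipWith₃ triple σ φ v u′)))
        (∏-* (edges G) (λ (u , u′) → w₁ (Vec.lookup σ u) (Vec.lookup φ u) (Vec.lookup σ u′) (Vec.lookup φ u′))
                       (λ (u , u′) → w₂ (Vec.lookup σ u) (Vec.lookup v u) (Vec.lookup σ u′) (Vec.lookup v u′)))
  where w = λ (s , φ , a) (t , ψ , b) → w₁ s φ t ψ * w₂ s a t b

-- Regrouping by types, and induced subgraphs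

module _ {N : ℕ} where

  count : Vec (Fin N) m → Fin N → ℕ
  count []       s = 0
  count (s₀ ∷ σ) s = if does (s₀ ≟ s) then suc (count σ s) else count σ s

  restrict : Vec (Fin N) m → Vec A m → Fin N → List A
  restrict []       []      s = []
  restrict (s₀ ∷ σ) (a ∷ v) s = if does (s₀ ≟ s) then a ∷ restrict σ v s else restrict σ v s

  _[_]≔_ : (Fin N → A) → Fin N → A → Fin N → A
  (f [ s₀ ]≔ y) s = if does (s₀ ≟ s) then y else f s

lists : ℕ → List A → List (List A)
lists c L = map Vec.toList (tuples c L)

∑-lists-suc : ∀ c (L : List A) g → ∑ (lists (suc c) L) g ≡ ∑ (lists c L) (λ w → ∑ L (λ a → g (a ∷ w)))
∑-lists-suc c L g = begin
  ∑ (lists (suc c) L) g                                       ≡⟨ ∑-map Vec.toList (tuples (suc c) L) g ⟩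
  ∑ (tuples (suc c) L) (g ∘ Vec.toList)                       ≡⟨ ∑-tuples-suc c L (g ∘ Vec.toList) ⟩
  ∑ (tuples c L) (λ w → ∑ L (λ a → g (a ∷ Vec.toList w)))     ≡⟨ ∑-map Vec.toList (tuples c L) _ ⟨
  ∑ (lists c L) (λ w → ∑ L (λ a → g (a ∷ w)))                 ∎
  where open ≡-Reasoning

∏-allFin-suc : ∀ {N} (f : Fin (suc N) → ℕ) → ∏ (allFin (suc N)) f ≡ f Fin.zero * ∏ (allFin N) (f ∘ Fin.suc)
∏-allFin-suc {N} f = cong (f Fin.zero *_)
  (trans (cong (λ L → ∏ L f) (sym (List.map-tabulate (λ i → i) Fin.suc))) (∏-map Fin.suc (allFin N) f))

∏-≔ : ∀ {N} (f : Fin N → ℕ) s₀ y → ∏ (allFin N) (f [ s₀ ]≔ y) ≡ y * ∏ (allFin N) (f [ s₀ ]≔ 1)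
∏-≔ {suc N} f Fin.zero      y = begin
  ∏ (allFin (suc N)) (f [ Fin.zero ]≔ y)       ≡⟨ ∏-allFin-suc (f [ Fin.zero ]≔ y) ⟩
  y * ∏ (allFin N) (f ∘ Fin.suc)               ≡⟨ cong (y *_) (*-identityˡ _) ⟨
  y * (1 * ∏ (allFin N) (f ∘ Fin.suc))         ≡⟨ cong (y *_) (∏-allFin-suc (f [ Fin.zero ]≔ 1)) ⟨
  y * ∏ (allFin (suc N)) (f [ Fin.zero ]≔ 1)   ∎
  where open ≡-Reasoning
∏-≔ {suc N} f (Fin.suc s₀) y = begin
  ∏ (allFin (suc N)) (f [ Fin.suc s₀ ]≔ y)             ≡⟨ ∏-allFin-suc (f [ Fin.suc s₀ ]≔ y) ⟩
  f Fin.zero * ∏ (allFin N) ((f ∘ Fin.suc) [ s₀ ]≔ y)   ≡⟨ cong (f Fin.zero *_) (∏-≔ (f ∘ Fin.suc) s₀ y) ⟩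
  f Fin.zero * (y * ∏ (allFin N) ((f ∘ Fin.suc) [ s₀ ]≔ 1)) ≡⟨ *-exchangeˡ (f Fin.zero) y _ ⟩
  y * (f Fin.zero * ∏ (allFin N) ((f ∘ Fin.suc) [ s₀ ]≔ 1)) ≡⟨ cong (y *_) (∏-allFin-suc (f [ Fin.suc s₀ ]≔ 1)) ⟨
  y * ∏ (allFin (suc N)) (f [ Fin.suc s₀ ]≔ 1)         ∎
  where open ≡-Reasoning

∑-∏-≔ : ∀ {N} (L : List A) (f : Fin N → ℕ) s₀ (g : A → ℕ) →
  ∑ L (λ a → ∏ (allFin N) (f [ s₀ ]≔ g a)) ≡ ∏ (allFin N) (f [ s₀ ]≔ ∑ L g)
∑-∏-≔ {N = N} L f s₀ g = begin
  ∑ L (λ a → ∏ (allFin N) (f [ s₀ ]≔ g a))      ≡⟨ ∑-cong L (λ a → ∏-≔ f s₀ (g a)) ⟩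
  ∑ L (λ a → g a * ∏ (allFin N) (f [ s₀ ]≔ 1))  ≡⟨ ∑-* L _ g ⟨
  ∑ L g * ∏ (allFin N) (f [ s₀ ]≔ 1)            ≡⟨ ∏-≔ f s₀ (∑ L g) ⟨
  ∏ (allFin N) (f [ s₀ ]≔ ∑ L g)                ∎
  where open ≡-Reasoning

∏-only : ∀ {N} (f : Fin N → ℕ) s₀ → (∀ s → ¬ s₀ ≡ s → f s ≡ 1) → ∏ (allFin N) f ≡ f s₀
∏-only {N} f s₀ f≡1 = begin
  ∏ (allFin N) f                       ≡⟨ ∏-cong (allFin N) f≡f[s₀]≔fs₀ ⟩
  ∏ (allFin N) (f [ s₀ ]≔ f s₀)        ≡⟨ ∏-≔ f s₀ (f s₀) ⟩
  f s₀ * ∏ (allFin N) (f [ s₀ ]≔ 1)    ≡⟨ cong (f s₀ *_) (trans (∏-cong (allFin N) rest≡1) (∏-one (allFin N))) ⟩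
  f s₀ * 1                             ≡⟨ *-identityʳ (f s₀) ⟩
  f s₀                                 ∎
  where
  open ≡-Reasoning
  f≡f[s₀]≔fs₀ : ∀ s → f s ≡ (f [ s₀ ]≔ f s₀) s
  f≡f[s₀]≔fs₀ s with s₀ ≟ s
  ... | yes refl = refl
  ... | no  _    = refl
  rest≡1 : ∀ s → (f [ s₀ ]≔ 1) s ≡ 1
  rest≡1 s with s₀ ≟ s
  ... | yes _   = refl
  ... | no  s≢s₀ = f≡1 s s≢s₀

fubini : ∀ {N} (V : Fin N → List A) (σ : Vec (Fin N) m) (g : Fin N → List A → ℕ) →
  ∑ (tuplesD V σ) (λ v → ∏ (allFin N) (λ s → g s (restrict σ v s))) ≡
  ∏ (allFin N) (λ s → ∑ (lists (count σ s) (V s)) (g s))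
fubini {N = N} V []       g = trans (+-identityʳ _) (∏-cong (allFin N) (λ s → sym (+-identityʳ (g s []))))
fubini {N = N} V (s₀ ∷ σ) g = begin
  ∑ (tuplesD V (s₀ ∷ σ)) (λ v → ∏ (allFin N) (λ s → g s (restrict (s₀ ∷ σ) v s)))
    ≡⟨ ∑-tuplesD-∷ V s₀ σ _ ⟩
  ∑ (tuplesD V σ) (λ r → ∑ (V s₀) (λ a → ∏ (allFin N) (λ s → g s (restrict (s₀ ∷ σ) (a ∷ r) s))))
    ≡⟨ ∑-cong (tuplesD V σ) (λ r → ∑-cong (V s₀) (λ a → ∏-cong (allFin N) (restrict-∷ r a))) ⟩
  ∑ (tuplesD V σ) (λ r → ∑ (V s₀) (λ a → ∏ (allFin N) (gσ r [ s₀ ]≔ g s₀ (a ∷ restrict σ r s₀))))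
    ≡⟨ ∑-cong (tuplesD V σ) (λ r → ∑-∏-≔ (V s₀) (gσ r) s₀ (λ a → g s₀ (a ∷ restrict σ r s₀))) ⟩
  ∑ (tuplesD V σ) (λ r → ∏ (allFin N) (gσ r [ s₀ ]≔ ∑ (V s₀) (λ a → g s₀ (a ∷ restrict σ r s₀))))
    ≡⟨ ∑-cong (tuplesD V σ) (λ r → ∏-cong (allFin N) (absorb r)) ⟩
  ∑ (tuplesD V σ) (λ r → ∏ (allFin N) (λ s → g′ s (restrict σ r s)))
    ≡⟨ fubini V σ g′ ⟩
  ∏ (allFin N) (λ s → ∑ (lists (count σ s) (V s)) (g′ s))
    ≡⟨ ∏-cong (allFin N) lists-∷ ⟩
  ∏ (allFin N) (λ s → ∑ (lists (count (s₀ ∷ σ) s) (V s)) (g s)) ∎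
  where
  open ≡-Reasoning
  gσ : _ → Fin N → ℕ
  gσ r s = g s (restrict σ r s)
  g′ : Fin N → List _ → ℕ
  g′ s w = if does (s₀ ≟ s) then ∑ (V s) (λ a → g s (a ∷ w)) else g s w
  restrict-∷ : ∀ r a s → g s (restrict (s₀ ∷ σ) (a ∷ r) s) ≡ (gσ r [ s₀ ]≔ g s₀ (a ∷ restrict σ r s₀)) s
  restrict-∷ r a s with s₀ ≟ s
  ... | yes refl = refl
  ... | no  _    = refl
  absorb : ∀ r s → (gσ r [ s₀ ]≔ ∑ (V s₀) (λ a → g s₀ (a ∷ restrict σ r s₀))) s ≡ g′ s (restrict σ r s)
  absorb r s with s₀ ≟ s
  ... | yes refl = refl
  ... | no  _    = refl
  lists-∷ : ∀ s → ∑ (lists (count σ s) (V s)) (g′ s) ≡ ∑ (lists (count (s₀ ∷ σ) s) (V s)) (g s)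
  lists-∷ s with s₀ ≟ s
  ... | yes refl = sym (∑-lists-suc (count σ s₀) (V s₀) (g s₀))
  ... | no  _    = refl

-- Ornament vertices are handled as numbers, so that all vertices of the composition live in
-- one type; numbers outside the vertex range are isolated.
adjℕ : Graph → ℕ → ℕ → ℕ
adjℕ G a b with a <? size G | b <? size G
... | yes a<n | yes b<n = adj G (fromℕ< a<n) (fromℕ< b<n)
... | _       | _       = 0

adjℕ-toℕ : ∀ G (a b : Fin (size G)) → adjℕ G (toℕ a) (toℕ b) ≡ adj G a b
adjℕ-toℕ G a b with toℕ a <? size G | toℕ b <? size G
... | yes a<n | yes b<n = cong₂ (adj G) (Fin.fromℕ<-toℕ a a<n) (Fin.fromℕ<-toℕ b b<n)
... | yes _   | no  b≮n = ⊥-elim (b≮n (Fin.toℕ<n b))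
... | no  a≮n | _       = ⊥-elim (a≮n (Fin.toℕ<n a))

toList-! : ∀ (w : Vec ℕ m) i → Vec.toList w ! toℕ i ≡ Vec.lookup w i
toList-! (a ∷ w) Fin.zero    = refl
toList-! (a ∷ w) (Fin.suc i) = toList-! w i

listWeight : (G : MGraph) → (ℕ → ℕ → ℕ) → List ℕ → ℕ
listWeight G w c = ∏ (edges G) (λ (a , b) → w (c ! toℕ a) (c ! toℕ b))

hom-lists : ∀ G F → hom G F ≡ ∑ (lists (n G) (map toℕ (allFin (size F)))) (listWeight G (adjℕ F))
hom-lists G F = begin
  ∑ (allMaps (n G) (size F)) (weight G (adj F))
    ≡⟨ ∑-cong (allMaps (n G) (size F)) (λ f → trans (∏-cong (edges G) (λ (a , b) → sym (adjℕ-toℕ F _ _)))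
                                                    (sym (weight-map G (adjℕ F) toℕ f))) ⟩
  ∑ (allMaps (n G) (size F)) (weight G (adjℕ F) ∘ Vec.map toℕ)
    ≡⟨ cong (λ M → ∑ M (weight G (adjℕ F) ∘ Vec.map toℕ)) (allMaps≡tuples (n G) (size F)) ⟩
  ∑ (tuples (n G) (allFin (size F))) (weight G (adjℕ F) ∘ Vec.map toℕ)
    ≡⟨ ∑-tuples-map (n G) (allFin (size F)) toℕ (weight G (adjℕ F)) ⟩
  ∑ (tuples (n G) V) (weight G (adjℕ F))
    ≡⟨ ∑-cong (tuples (n G) V) (λ w → ∏-cong (edges G) (λ (a , b) →
         sym (cong₂ (adjℕ F) (toList-! w a) (toList-! w b)))) ⟩
  ∑ (tuples (n G) V) (listWeight G (adjℕ F) ∘ Vec.toList)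
    ≡⟨ ∑-map Vec.toList (tuples (n G) V) (listWeight G (adjℕ F)) ⟨
  ∑ (lists (n G) V) (listWeight G (adjℕ F)) ∎
  where
  open ≡-Reasoning
  V = map toℕ (allFin (size F))

module _ {N : ℕ} where

  rank : Vec (Fin N) m → Fin N → Fin m → ℕ
  rank (s₀ ∷ σ) s Fin.zero    = 0
  rank (s₀ ∷ σ) s (Fin.suc u) = if does (s₀ ≟ s) then suc (rank σ s u) else rank σ s u

  rank<count : ∀ (σ : Vec (Fin N) m) {s} u → s ≡ Vec.lookup σ u → rank σ s u < count σ s
  rank<count (s₀ ∷ σ) {s} Fin.zero    s≡s₀ with s₀ ≟ s
  ... | yes _    = z<s
  ... | no  s₀≢s = ⊥-elim (s₀≢s (sym s≡s₀))
  rank<count (s₀ ∷ σ) {s} (Fin.suc u) s≡σu with s₀ ≟ s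
  ... | yes _ = s<s (rank<count σ u s≡σu)
  ... | no  _ = rank<count σ u s≡σu

  restrict-rank : ∀ (σ : Vec (Fin N) m) v {s} u → s ≡ Vec.lookup σ u → restrict σ v s ! rank σ s u ≡ Vec.lookup v u
  restrict-rank (s₀ ∷ σ) (a ∷ v) {s} Fin.zero    s≡s₀ with s₀ ≟ s
  ... | yes _    = refl
  ... | no  s₀≢s = ⊥-elim (s₀≢s (sym s≡s₀))
  restrict-rank (s₀ ∷ σ) (a ∷ v) {s} (Fin.suc u) s≡σu with s₀ ≟ s
  ... | yes _ = restrict-rank σ v u s≡σu
  ... | no  _ = restrict-rank σ v u s≡σu

  inducedEdge : (σ : Vec (Fin N) m) (s : Fin N) → Fin m × Fin m → List (Fin (count σ s) × Fin (count σ s))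
  inducedEdge σ s (u , u′) with s ≟ Vec.lookup σ u | s ≟ Vec.lookup σ u′
  ... | yes s≡σu | yes s≡σu′ = [ fromℕ< (rank<count σ u s≡σu) , fromℕ< (rank<count σ u′ s≡σu′) ]
  ... | _        | _         = []

  induced : (G : MGraph) → Vec (Fin N) (n G) → Fin N → MGraph
  induced G σ s = record { n = count σ s ; edges = concatMap (inducedEdge σ s) (edges G) }

  module _ (σ : Vec (Fin N) m) (v : Vec ℕ m) (W : Fin N → ℕ → ℕ → ℕ) where

    inducedEdgeWeight : Fin N → Fin m × Fin m → ℕ
    inducedEdgeWeight s e = ∏ (inducedEdge σ s e) (λ (a , b) → W s (restrict σ v s ! toℕ a) (restrict σ v s ! toℕ b))

    inducedEdgeWeight-at : ∀ u u′ → inducedEdgeWeight (Vec.lookup σ u) (u , u′) ≡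
      (if does (Vec.lookup σ u ≟ Vec.lookup σ u′) then W (Vec.lookup σ u) (Vec.lookup v u) (Vec.lookup v u′) else 1)
    inducedEdgeWeight-at u u′ with Vec.lookup σ u ≟ Vec.lookup σ u | Vec.lookup σ u ≟ Vec.lookup σ u′
    ... | yes s≡σu | yes s≡σu′ = trans (*-identityʳ _) (cong₂ (W (Vec.lookup σ u))
                                   (trans (cong (restrict σ v (Vec.lookup σ u) !_) (Fin.toℕ-fromℕ< _)) (restrict-rank σ v u s≡σu))
                                   (trans (cong (restrict σ v (Vec.lookup σ u) !_) (Fin.toℕ-fromℕ< _)) (restrict-rank σ v u′ s≡σu′)))
    ... | yes _    | no  _     = refl
    ... | no  σu≢σu | _        = ⊥-elim (σu≢σu refl)

    inducedEdgeWeight-off : ∀ u u′ s → ¬ Vec.lookup σ u ≡ s → inducedEdgeWeight s (u , u′) ≡ 1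
    inducedEdgeWeight-off u u′ s σu≢s with s ≟ Vec.lookup σ u | s ≟ Vec.lookup σ u′
    ... | yes s≡σu | yes _ = ⊥-elim (σu≢s (sym s≡σu))
    ... | yes _    | no  _ = refl
    ... | no  _    | _     = refl

  weight₂-induced : ∀ G σ (W : Fin N → ℕ → ℕ → ℕ) v →
    weight₂ G (λ s a t b → if does (s ≟ t) then W s a b else 1) σ v ≡
    ∏ (allFin N) (λ s → listWeight (induced G σ s) (W s) (restrict σ v s))
  weight₂-induced G σ W v = sym (begin
    ∏ (allFin N) (λ s → ∏ (concatMap (inducedEdge σ s) (edges G)) _)
      ≡⟨ ∏-cong (allFin N) (λ s → ∏-concatMap (inducedEdge σ s) (edges G) _) ⟩
    ∏ (allFin N) (λ s → ∏ (edges G) (inducedEdgeWeight σ v W s))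
      ≡⟨ ∏-swap (allFin N) (edges G) (inducedEdgeWeight σ v W) ⟩
    ∏ (edges G) (λ e → ∏ (allFin N) (λ s → inducedEdgeWeight σ v W s e))
      ≡⟨ ∏-cong (edges G) (λ (u , u′) → trans (∏-only _ (Vec.lookup σ u) (inducedEdgeWeight-off σ v W u u′))
                                               (inducedEdgeWeight-at σ v W u u′)) ⟩
    weight₂ G (λ s a t b → if does (s ≟ t) then W s a b else 1) σ v ∎)
    where open ≡-Reasoning

ornamentAdj : ∀ {N} → (Fin N → Graph) → Fin N → ℕ → Fin N → ℕ → ℕ
ornamentAdj Fx s a t b = if does (s ≟ t) then adjℕ (Fx s) a b else 1

ornament-factor : ∀ {N} (Fx : Fin N → Graph) G σ →
  ∑ (tuplesD (λ s → map toℕ (allFin (size (Fx s)))) σ) (weight₂ G (ornamentAdj Fx) σ) ≡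
  ∏ (allFin N) (λ s → hom (induced G σ s) (Fx s))
ornament-factor {N} Fx G σ = begin
  ∑ (tuplesD V σ) (weight₂ G (ornamentAdj Fx) σ)
    ≡⟨ ∑-cong (tuplesD V σ) (weight₂-induced G σ (adjℕ ∘ Fx)) ⟩
  ∑ (tuplesD V σ) (λ v → ∏ (allFin N) (λ s → listWeight (induced G σ s) (adjℕ (Fx s)) (restrict σ v s)))
    ≡⟨ fubini V σ (λ s → listWeight (induced G σ s) (adjℕ (Fx s))) ⟩
  ∏ (allFin N) (λ s → ∑ (lists (count σ s) (V s)) (listWeight (induced G σ s) (adjℕ (Fx s))))
    ≡⟨ ∏-cong (allFin N) (λ s → hom-lists (induced G σ s) (Fx s)) ⟨
  ∏ (allFin N) (λ s → hom (induced G σ s) (Fx s)) ∎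
  where
  open ≡-Reasoning
  V = λ s → map toℕ (allFin (size (Fx s)))

-- Adjacency of copies

m∸n+o<m : ∀ {m n o} → n ≤ m → o < n → m ∸ n + o < m
m∸n+o<m {m} {n} {o} n≤m o<n = subst (m ∸ n + o <_) (m∸n+n≡m n≤m) (+-monoʳ-< (m ∸ n) o<n)

module Copies {N : ℕ} (T : RootedTree N) (H : Fin N → Fin N → Bool) where

  copyAdj : Fin N → List ℕ → Fin N → List ℕ → ℕ
  copyAdj s φ t ψ with s ≟ t
  ... | yes _ = 𝟙 ⌊ ≡-dec _≟ℕ_ φ ψ ⌋
  ... | no  _ = 𝟙 (H s t ∧ (restrictsTo φ ψ ∨ restrictsTo ψ φ))

  L : Fin N → ℕ
  L s = length (P T s)

  blockEqs : ℕ → ℕ → ℕ → ℕ → List (ℕ × ℕ)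
  blockEqs oa ob d len = map (λ i → oa + (d + i) , ob + i) (upTo len)

  -- Paths run from a vertex up to the root, so restricting the copy of the deeper vertex drops
  -- its first entries.
  edgeEqs : Fin N → Fin N → ℕ → ℕ → List (ℕ × ℕ)
  edgeEqs s t oa ob with s ≟ t
  ... | yes _ = blockEqs oa ob 0 (L s)
  ... | no  _ with H s t
  ...   | false = []
  ...   | true with L t ≤? L s
  ...     | yes _ = blockEqs oa ob (L s ∸ L t) (L t)
  ...     | no  _ = blockEqs ob oa (L t ∸ L s) (L s)

  allowed : Fin N → Fin N → ℕ
  allowed s t with s ≟ t
  ... | yes _ = 1
  ... | no  _ = 𝟙 (H s t)

  solves-blockEqs : ∀ c p q {oa ob d len} →
    (∀ {i} → i < d + len → c ! (oa + i) ≡ p ! i) → (∀ {i} → i < len → c ! (ob + i) ≡ q ! i) →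
    ∏ (upTo len) (λ i → δ (p ! (d + i)) (q ! i)) ≡ solves c (blockEqs oa ob d len)
  solves-blockEqs c p q {oa} {ob} {d} {len} p-block q-block =
    trans (∏-cong-∈ (upTo len) (λ i∈ → sym (cong₂ δ (p-block (+-monoʳ-< d (∈-upTo⁻ i∈))) (q-block (∈-upTo⁻ i∈)))))
          (sym (∏-map (λ i → oa + (d + i) , ob + i) (upTo len) (λ (i , j) → δ (c ! i) (c ! j))))

  𝟙-restrictsTo-blocks : ∀ c p q {oa ob Lp Lq} → length p ≡ Lp → length q ≡ Lq → Lq ≤ Lp →
    (∀ {i} → i < Lp → c ! (oa + i) ≡ p ! i) → (∀ {i} → i < Lq → c ! (ob + i) ≡ q ! i) →
    𝟙 (restrictsTo p q ∨ restrictsTo q p) ≡ solves c (blockEqs oa ob (Lp ∸ Lq) Lq)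
  𝟙-restrictsTo-blocks c p q refl refl q≤p p-block q-block =
    trans (𝟙-restrictsTo p q q≤p) (solves-blockEqs c p q (p-block ∘ subst (_ <_) (m∸n+n≡m q≤p)) q-block)

  copyAdj-blocks : ∀ s t c φa φb {oa ob} → length φa ≡ L s → length φb ≡ L t →
    (∀ {i} → i < L s → c ! (oa + i) ≡ φa ! i) → (∀ {i} → i < L t → c ! (ob + i) ≡ φb ! i) →
    copyAdj s φa t φb ≡ allowed s t * solves c (edgeEqs s t oa ob)
  copyAdj-blocks s t c φa φb {oa} {ob} |φa| |φb| a-block b-block with s ≟ t
  ... | yes refl = begin
    𝟙 ⌊ ≡-dec _≟ℕ_ φa φb ⌋                            ≡⟨ 𝟙-≡ φa φb (trans |φa| (sym |φb|)) ⟩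
    ∏ (upTo (length φb)) (λ i → δ (φa ! i) (φb ! i))  ≡⟨ cong (λ len → ∏ (upTo len) (λ i → δ (φa ! i) (φb ! i))) |φb| ⟩
    ∏ (upTo (L s)) (λ i → δ (φa ! i) (φb ! i))        ≡⟨ solves-blockEqs c φa φb a-block b-block ⟩
    solves c (blockEqs oa ob 0 (L s))                 ≡⟨ *-identityˡ _ ⟨
    1 * solves c (blockEqs oa ob 0 (L s))             ∎
    where open ≡-Reasoning
  ... | no  _ with H s t
  ...   | false = refl
  ...   | true with L t ≤? L s
  ...     | yes Lt≤Ls = trans (𝟙-restrictsTo-blocks c φa φb |φa| |φb| Lt≤Ls a-block b-block) (sym (*-identityˡ _))
  ...     | no  Lt≰Ls = trans (cong 𝟙 (∨-comm (restrictsTo φa φb) (restrictsTo φb φa)))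
                          (trans (𝟙-restrictsTo-blocks c φb φa |φb| |φa| (<⇒≤ (≰⇒> Lt≰Ls)) b-block a-block)
                                 (sym (*-identityˡ _)))

  flat : Vec (Fin N) m → List (Fin N)
  flat σ = List.concat (Vec.toList (Vec.map (P T) σ))

  typeFactor : (G : MGraph) → Vec (Fin N) (n G) → ℕ
  typeFactor G σ = ∏ (edges G) (λ (u , v) → allowed (Vec.lookup σ u) (Vec.lookup σ v))

  constraints : (G : MGraph) → Vec (Fin N) (n G) → List (ℕ × ℕ)
  constraints G σ =
    concatMap (λ (u , v) → edgeEqs (Vec.lookup σ u) (Vec.lookup σ v) (offset L σ u) (offset L σ v)) (edges G)

  weight₂-copyAdj : ∀ G σ φ → (∀ u → length (Vec.lookup φ u) ≡ L (Vec.lookup σ u)) →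
    weight₂ G copyAdj σ φ ≡ typeFactor G σ * solves (List.concat (Vec.toList φ)) (constraints G σ)
  weight₂-copyAdj G σ φ lengths = begin
    weight₂ G copyAdj σ φ
      ≡⟨ ∏-cong (edges G) (λ (u , v) →
           copyAdj-blocks (σ! u) (σ! v) c (φ! u) (φ! v) (lengths u) (lengths v) (block u) (block v)) ⟩
    ∏ (edges G) (λ (u , v) → allowed (σ! u) (σ! v) * solves c (eqs (u , v)))
      ≡⟨ ∏-* (edges G) (λ (u , v) → allowed (σ! u) (σ! v)) (λ e → solves c (eqs e)) ⟩
    typeFactor G σ * ∏ (edges G) (λ e → solves c (eqs e))
      ≡⟨ cong (typeFactor G σ *_) (∏-concatMap eqs (edges G) _) ⟨
    typeFactor G σ * solves c (constraints G σ) ∎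
    where
    open ≡-Reasoning
    c = List.concat (Vec.toList φ)
    σ! = Vec.lookup σ
    φ! = Vec.lookup φ
    eqs = λ (u , v) → edgeEqs (σ! u) (σ! v) (offset L σ u) (offset L σ v)
    block : ∀ u {i} → i < L (σ! u) → c ! (offset L σ u + i) ≡ φ! u ! i
    block u i<L = cong (fromMaybe 0) (concat-‼ L σ φ lengths u i<L)

  copy-factor : ∀ (k : Fin N → ℕ) G σ →
    ∑ (tuplesD (λ s → assignments k (P T s)) σ) (weight₂ G copyAdj σ) ≡ typeFactor G σ * #solutions k (flat σ) (constraints G σ)
  copy-factor k G σ = begin
    ∑ (tuplesD copies σ) (weight₂ G copyAdj σ)
      ≡⟨ ∑-cong-∈ (tuplesD copies σ) (λ {φ} φ∈ → weight₂-copyAdj G σ φ (λ u →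
           sym (Pointwise-length (∈-assignments⁻ k (P T (Vec.lookup σ u)) (∈-tuplesD⁻ copies σ φ∈ u))))) ⟩
    ∑ (tuplesD copies σ) (λ φ → typeFactor G σ * solves (List.concat (Vec.toList φ)) (constraints G σ))
      ≡⟨ ∑-tuplesD-assignments k (P T) σ (λ c → typeFactor G σ * solves c (constraints G σ)) ⟩
    ∑ (assignments k (flat σ)) (λ c → typeFactor G σ * solves c (constraints G σ))
      ≡⟨ *-∑ (assignments k (flat σ)) (typeFactor G σ) _ ⟨
    typeFactor G σ * #solutions k (flat σ) (constraints G σ) ∎
    where
    open ≡-Reasoning
    copies = λ s → assignments k (P T s)

  module _ (H-spanning : SpanningSubgraphOfClos T H) where

    P-‼-suffix : ∀ {s t} → H s t ≡ true → L t ≤ L s → ∀ i → P T s ‼ (L s ∸ L t + i) ≡ P T t ‼ i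
    P-‼-suffix {s} {t} Hst Lt≤Ls i with proj₂ H-spanning s t Hst
    ... | inj₁ t-above-s with pre , _ , Ps≡ ← P-ancestor T t-above-s =
      trans (cong (λ xs → xs ‼ (length xs ∸ L t + i)) Ps≡) (‼-suffix pre (P T t) i)
    ... | inj₂ s-above-t with pre , 0<pre , Pt≡ ← P-ancestor T s-above-t =
      ⊥-elim (<⇒≱ (subst (L s <_) (sym (trans (cong length Pt≡) (List.length-++ pre))) (+-monoˡ-< (L s) 0<pre)) Lt≤Ls)

    blockEqs-typed : ∀ (τ : List (Fin N)) {oa ob d len} → (∀ {i} → i < len → τ ‼ (oa + (d + i)) ≡ τ ‼ (ob + i)) →
      WellTyped τ (blockEqs oa ob d len)
    blockEqs-typed τ {len = len} same = map⁺ (applyUpTo⁺₁ (λ i → i) len same)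

    edgeEqs-typed : ∀ (τ : List (Fin N)) s t {oa ob} → (∀ {i} → i < L s → τ ‼ (oa + i) ≡ P T s ‼ i) →
      (∀ {i} → i < L t → τ ‼ (ob + i) ≡ P T t ‼ i) → WellTyped τ (edgeEqs s t oa ob)
    edgeEqs-typed τ s t {oa} {ob} a-typed b-typed with s ≟ t
    ... | yes refl = blockEqs-typed τ {oa} {ob} {0} (λ i<L → trans (a-typed i<L) (sym (b-typed i<L)))
    ... | no  _ with H s t in Hst
    ...   | false = []
    ...   | true with L t ≤? L s
    ...     | yes Lt≤Ls = blockEqs-typed τ {oa} {ob} {L s ∸ L t} (λ {i} i<Lt →
                trans (a-typed (m∸n+o<m Lt≤Ls i<Lt)) (trans (P-‼-suffix Hst Lt≤Ls i) (sym (b-typed i<Lt))))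
    ...     | no  Lt≰Ls = blockEqs-typed τ {ob} {oa} {L t ∸ L s} (λ {i} i<Ls →
                trans (b-typed (m∸n+o<m Ls≤Lt i<Ls)) (trans (P-‼-suffix Hts Ls≤Lt i) (sym (a-typed i<Ls))))
      where
      Ls≤Lt = <⇒≤ (≰⇒> Lt≰Ls)
      Hts = trans (sym (proj₁ H-spanning s t)) Hst

    constraints-typed : ∀ G σ → WellTyped (flat σ) (constraints G σ)
    constraints-typed G σ = concat⁺ (map⁺ (All.universal (λ (u , v) →
      edgeEqs-typed (flat σ) (Vec.lookup σ u) (Vec.lookup σ v) (flat-‼ u) (flat-‼ v)) (edges G)))
      where
      flat-‼ : ∀ u {i} → i < L (Vec.lookup σ u) → flat σ ‼ (offset L σ u + i) ≡ P T (Vec.lookup σ u) ‼ i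
      flat-‼ u {i} i<L = trans (concat-‼ L σ (Vec.map (P T) σ) (λ w → cong length (Vec.lookup-map w (P T) σ)) u i<L)
                               (cong (_‼ i) (Vec.lookup-map u (P T) σ))

-- Decomposition of the branched composition

module BranchedComposition {N : ℕ} (T : RootedTree N) (H : Fin N → Fin N → Bool) (h : Fin N → ℕ)
                           (F : (s : Fin N) → (Fin (h s) → ℕ) → Graph) where

  open Copies T H using (copyAdj; typeFactor; flat; constraints; copy-factor)

  module _ (x : Idx h → ℕ) where
    open Branched T H h F x using (j; k; Vtx; verts; adjV; graph)

    ornament : Fin N → Graph
    ornament s = F s (j s)

    copies : Fin N → List (List ℕ)
    copies s = assignments k (P T s)

    ornamentVertices : Fin N → List ℕ
    ornamentVertices s = map toℕ (allFin (size (ornament s)))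

    split : Vtx → Fin N × List ℕ × ℕ
    split (s , φ , v) = s , φ , toℕ v

    splitAdj : Fin N × List ℕ × ℕ → Fin N × List ℕ × ℕ → ℕ
    splitAdj (s , φ , a) (t , ψ , b) = copyAdj s φ t ψ * ornamentAdj ornament s a t b

    adjV-split : ∀ p q → adjV p q ≡ splitAdj (split p) (split q)
    adjV-split (s , φ , v) (t , ψ , w) with s ≟ t
    ... | no  _    = sym (*-identityʳ _)
    ... | yes refl with ⌊ ≡-dec _≟ℕ_ φ ψ ⌋
    ...   | true  = sym (trans (+-identityʳ _) (adjℕ-toℕ (ornament s) v w))
    ...   | false = refl

    map-split-verts : map split verts ≡
      concatMap (λ s → concatMap (λ φ → map (triple s φ) (ornamentVertices s)) (copies s)) (allFin N)
    map-split-verts =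
      trans (List.map-concatMap split _ (allFin N)) (List.concatMap-cong (λ s →
        trans (List.map-concatMap split _ (copies s)) (List.concatMap-cong (λ φ →
          let vs = allFin (size (ornament s)) in trans (sym (List.map-∘ vs)) (List.map-∘ vs))
        (copies s))) (allFin N))

    hom-decomposition : ∀ G → hom G graph ≡
      ∑ (tuples (n G) (allFin N)) (λ σ → ∑ (tuplesD copies σ) (weight₂ G copyAdj σ) *
                                         ∑ (tuplesD ornamentVertices σ) (weight₂ G (ornamentAdj ornament) σ))
    hom-decomposition G = begin
      hom G graph
        ≡⟨ hom-listed G verts adjV ⟩
      ∑ (tuples (n G) verts) (weight G adjV)
        ≡⟨ ∑-cong (tuples (n G) verts) (λ φ → trans (∏-cong (edges G) (λ (u , v) → adjV-split (Vec.lookup φ u) (Vec.lookup φ v)))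
                                                      (sym (weight-map G splitAdj split φ))) ⟩
      ∑ (tuples (n G) verts) (weight G splitAdj ∘ Vec.map split)
        ≡⟨ ∑-tuples-map (n G) verts split (weight G splitAdj) ⟩
      ∑ (tuples (n G) (map split verts)) (weight G splitAdj)
        ≡⟨ cong (λ L → ∑ (tuples (n G) L) (weight G splitAdj)) map-split-verts ⟩
      ∑ (tuples (n G) (concatMap M (allFin N))) (weight G splitAdj)
        ≡⟨ ∑-tuples-concatMap (n G) (allFin N) M (weight G splitAdj) ⟩
      ∑ (tuples (n G) (allFin N)) (λ σ → ∑ (tuplesD M σ) (weight G splitAdj))
        ≡⟨ ∑-cong (tuples (n G) (allFin N)) (λ σ → ∑-tuplesD-product σ copies ornamentVertices triple _) ⟩
      ∑ (tuples (n G) (allFin N)) (λ σ → ∑ (tuplesD copies σ) (λ φ → ∑ (tuplesD ornamentVertices σ) (λ v →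
          weight G splitAdj (zipWith₃ triple σ φ v))))
        ≡⟨ ∑-cong (tuples (n G) (allFin N)) (λ σ →
             trans (∑-cong (tuplesD copies σ) (λ φ → ∑-cong (tuplesD ornamentVertices σ) (λ v →
                      weight-zipWith₃ G copyAdj (ornamentAdj ornament) σ φ v)))
                   (∑-*-∑ (tuplesD copies σ) (tuplesD ornamentVertices σ) _ _)) ⟩
      ∑ (tuples (n G) (allFin N)) (λ σ → ∑ (tuplesD copies σ) (weight₂ G copyAdj σ) *
                                         ∑ (tuplesD ornamentVertices σ) (weight₂ G (ornamentAdj ornament) σ)) ∎
      where
      open ≡-Reasoning
      M = λ s → concatMap (λ φ → map (triple s φ) (ornamentVertices s)) (copies s)

    hom-branched : ∀ G → hom G graph ≡
      ∑ (tuples (n G) (allFin N)) (λ σ → typeFactor G σ * #solutions k (flat σ) (constraints G σ) *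
                                         ∏ (allFin N) (λ s → hom (induced G σ s) (ornament s)))
    hom-branched G = trans (hom-decomposition G) (∑-cong (tuples (n G) (allFin N)) (λ σ →
      cong₂ _*_ (copy-factor k G σ) (ornament-factor ornament G σ)))

theorem4p1 : (N : ℕ) (T : RootedTree N) (H : Fin N → Fin N → Bool) →
    SpanningSubgraphOfClos T H →
    (h : Fin N → ℕ) (F : (s : Fin N) → (Fin (h s) → ℕ) → Graph) →
    (∀ s js → Symmetric (F s js)) →
    (∀ s → StronglyPolynomial (F s)) →
    StronglyPolynomial (branchedComposition T H h F)
theorem4p1 N T H H-spanning h F _ F-polynomial = stronglyPolynomial {Hs = branchedComposition T H h F} λ G →
  polynomial-resp (λ x _ → sym (hom-branched x G))
    (∑-polynomial (tuples (n G) (allFin N)) λ σ → *-polynomial (copies-polynomial G σ) (ornaments-polynomial G σ))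
  where
  open BranchedComposition T H h F
  open Copies T H

  copies-polynomial : ∀ G σ → Polynomial (λ x → typeFactor G σ * #solutions (x ∘ inj₂) (flat σ) (constraints G σ))
  copies-polynomial G σ = *-polynomial (const-polynomial (typeFactor G σ)) (reindex-polynomial inj₂
    (#solutions-polynomial (flat σ) (constraints G σ) (constraints-typed H-spanning G σ)))

  ornaments-polynomial : ∀ G σ → Polynomial (λ x → ∏ (allFin N) (λ s → hom (induced G σ s) (F s (x ∘ inj₁ ∘ (s ,_)))))
  ornaments-polynomial G σ = ∏-polynomial (allFin N) λ s →
    reindex-polynomial (inj₁ ∘ (s ,_)) (hom-polynomial {Hs = F s} (F-polynomial s) (induced G σ s))
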